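{- Let $\mathsf{P}$ be a finite graded poset of rank $r$, $\kappa>0$, $\pi\in\mathcal{A}^{\mathrm{B}}_\kappa(\mathsf{P})$ and $x\in\mathsf{P}$. (1) If $\mathrm{rk}(x)=0$, then $(\mathrm{rvac}^{\mathrm{B}}_{\mathcal{A}}\pi)(x)=(\boldsymbol{\tau}_0\pi)(x)$. (2) If $\mathrm{rk}(x)\ge1$, then $(\mathrm{rvac}^{\mathrm{B}}_{\mathcal{A}}\pi)(x)=\big((\rho^{\mathrm{B}}_{\mathcal{A}})^{ -1}\circ\mathrm{rvac}^{\mathrm{B}}_{\mathcal{A}}\,\overline{\pi}\big)(x)$, where $\overline{\pi}=\pi|_{\mathsf{P}_{\ge1}}\in\mathcal{A}^{\mathrm{B}}_\kappa(\mathsf{P}_{\ge1})$ and $\rho^{\mathrm{B}}_{\mathcal{A}}$, $\mathrm{rvac}^{\mathrm{B}}_{\mathcal{A}}$ in this expression are the operators for the graded poset $\mathsf{P}_{\ge1}$.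
   Context: $\mathsf{P}$ graded of rank $r$ (minimal elements rank $0$, maximal rank $r$, rank $+1$ along covers); $\mathsf{P}_i$ = rank-$i$ elements; $\mathsf{P}_{\ge1}=\bigcup_{j\ge1}\mathsf{P}_j$, graded of rank $r-1$ with rank $\mathrm{rk}-1$. $\mathcal{A}^{\mathrm{B}}_\kappa(\mathsf{P})=\mathbb{R}_{>0}^{\mathsf{P}}$. Birational antichain toggle $\tau_p$: changes only the value at $p$, to $\kappa/\sum_{C}\prod_{y\in C}\pi(y)$, summing over maximal chains $C$ of $\mathsf{P}$ containing $p$. $\boldsymbol{\tau}_i=\prod_{p\in\mathsf{P}_i}\tau_p$; products are compositions, rightmost first. $\rho^{\mathrm{B}}_{\mathcal{A}}=\boldsymbol{\tau}_r\cdots\boldsymbol{\tau}_1\boldsymbol{\tau}_0$ and $\mathrm{rvac}^{\mathrm{B}}_{\mathcal{A}}=(\boldsymbol{\tau}_r)(\boldsymbol{\tau}_r\boldsymbol{\tau}_{r-1})\cdots(\boldsymbol{\tau}_r\cdots\boldsymbol{\tau}_1)(\boldsymbol{\tau}_r\cdots\boldsymbol{\tau}_1\boldsymbol{\tau}_0)$; for $\mathsf{P}_{\ge1}$ the same definitions are used with its own ranks and maximal chains. -}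

module Defs where

open import Data.Nat using (ℕ; zero; suc; _∸_; _≤_; _≤ᵇ_)
open import Data.Bool using (Bool; true; false; if_then_else_; _∧_; _∨_; not; T)
open import Data.Fin using (Fin)
open import Data.Fin.Properties using () renaming (_≟_ to _≟ᶠ_)
open import Data.Nat.Properties using () renaming (_≟_ to _≟ⁿ_)
open import Data.List using (List; []; _∷_; map; foldr; filter; allFin; concatMap; upTo)
open import Data.Vec using (Vec; []; _∷_; lookup)
open import Data.Maybe using (Maybe; just; nothing)
open import Relation.Nullary using (does; ¬_)
open import Relation.Binary.PropositionalEquality using (_≡_)

-- Commutative semifield (the algebraic structure of (ℝ_{>0}, +, ·, ⁻¹)).
-- The positive reals are an instance.

record Semifield : Set₁ where
  field
    Carrier  : Set
    _+_      : Carrier → Carrier → Carrier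
    _*_      : Carrier → Carrier → Carrier
    1#       : Carrier
    _⁻¹      : Carrier → Carrier
    +-assoc  : ∀ x y z → ((x + y) + z) ≡ (x + (y + z))
    +-comm   : ∀ x y → (x + y) ≡ (y + x)
    *-assoc  : ∀ x y z → ((x * y) * z) ≡ (x * (y * z))
    *-comm   : ∀ x y → (x * y) ≡ (y * x)
    *-identityˡ : ∀ x → (1# * x) ≡ x
    *-inverseʳ  : ∀ x → (x * (x ⁻¹)) ≡ 1#
    distribˡ : ∀ x y z → (x * (y + z)) ≡ ((x * y) + (x * z))

record FinPoset : Set where
  field
    n       : ℕ
    le      : Fin n → Fin n → Bool
    refl    : ∀ p → T (le p p)
    antisym : ∀ p q → T (le p q) → T (le q p) → p ≡ q
    trans   : ∀ p q s → T (le p q) → T (le q s) → T (le p s)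

module _ (P : FinPoset) where
  open FinPoset P

  Minimal : Fin n → Set
  Minimal p = ∀ q → T (le q p) → q ≡ p

  Maximal : Fin n → Set
  Maximal p = ∀ q → T (le p q) → q ≡ p

  Covers : Fin n → Fin n → Set
  Covers p q = T (le p q) × (¬ (p ≡ q)) ×
               (∀ z → T (le p z) → T (le z q) → (z ≡ p) ⊎ (z ≡ q))
    where open import Data.Product using (_×_)
          open import Data.Sum using (_⊎_)

  record IsGraded (r : ℕ) (rk : Fin n → ℕ) : Set where
    field
      min-rk   : ∀ p → Minimal p → rk p ≡ 0
      max-rk   : ∀ p → Maximal p → rk p ≡ r
      cover-rk : ∀ p q → Covers p q → rk q ≡ suc (rk p)

allSubsets : (n : ℕ) → List (Vec Bool n)
allSubsets zero = [] ∷ []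
allSubsets (suc n) = concatMap (λ v → (true ∷ v) ∷ (false ∷ v) ∷ []) (allSubsets n)

allB : ∀ {n} → (Fin n → Bool) → Bool
allB {n} f = foldr (λ p b → f p ∧ b) true (allFin n)

anyB : ∀ {n} → (Fin n → Bool) → Bool
anyB f = not (allB (λ p → not (f p)))

eqF : ∀ {n} → Fin n → Fin n → Bool
eqF p q = does (p ≟ᶠ q)

-- Birational antichain toggles on a "sub-poset" of a finite poset:
-- the elements p with mem p = true, with the induced order le,
-- rank function rk and rank r.  Labelings are functions Fin n → C;
-- only the values on members are ever read.

module Toggles (S : Semifield) (n : ℕ) (le : Fin n → Fin n → Bool)
               (mem : Fin n → Bool) (rk : Fin n → ℕ) (r : ℕ)
               (κ : Semifield.Carrier S) where
  open Semifield S

  Lab : Set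
  Lab = Fin n → Carrier

  _∈ˢ_ : Fin n → Vec Bool n → Bool
  p ∈ˢ X = lookup X p

  comparable : Fin n → Fin n → Bool
  comparable p q = le p q ∨ le q p

  isChainB : (Fin n → Bool) → Bool
  isChainB X = allB (λ p → allB (λ q → not (X p ∧ X q) ∨ comparable p q))

  isMaxChain : Vec Bool n → Bool
  isMaxChain X =
    allB (λ p → not (p ∈ˢ X) ∨ mem p) ∧
    isChainB (λ p → p ∈ˢ X) ∧
    allB (λ y → not (mem y) ∨ (y ∈ˢ X) ∨
                 not (isChainB (λ p → (p ∈ˢ X) ∨ eqF p y)))

  chainsThrough : Fin n → List (Vec Bool n)
  chainsThrough p = filter (λ X → T? (isMaxChain X ∧ (p ∈ˢ X))) (allSubsets n)
    where
      open import Relation.Nullary using (Dec; yes; no)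
      open import Data.Unit using (tt)
      T? : (b : Bool) → Dec (T b)
      T? true = yes tt
      T? false = no (λ ())

  prodOver : Lab → Vec Bool n → Carrier
  prodOver π X = foldr (λ p acc → if p ∈ˢ X then π p * acc else acc) 1# (allFin n)

  sumMaybe : List Carrier → Maybe Carrier
  sumMaybe [] = nothing
  sumMaybe (x ∷ xs) with sumMaybe xs
  ... | nothing = just x
  ... | just s  = just (x + s)

  -- τ_p : new value κ / Σ_{C ∋ p maximal chain} Π_{y ∈ C} π(y)
  -- (the sum is never empty in a graded poset; the 'nothing' branch is unreachable)
  toggle : Fin n → Lab → Lab
  toggle p π q with eqF q p
  ... | false = π q
  ... | true with sumMaybe (map (prodOver π) (chainsThrough p))
  ...   | just s  = κ * (s ⁻¹)
  ...   | nothing = π q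

  τrank : ℕ → Lab → Lab
  τrank i π = foldr (λ p σ → if mem p ∧ does (rk p ≟ⁿ i) then toggle p σ else σ)
                    π (allFin n)

  upFrom : ℕ → ℕ → Lab → Lab
  upFrom k zero π = τrank k π
  upFrom k (suc m) π = τrank (k Data.Nat.+ suc m) (upFrom k m π)

  upper : ℕ → Lab → Lab
  upper k = upFrom k (r ∸ k)

  rowmotion : Lab → Lab
  rowmotion = upper 0

  -- rvac = (τ_r)(τ_r τ_{r-1}) ⋯ (τ_r ⋯ τ_0): the factor τ_r⋯τ_0 is applied first
  rvacAux : ℕ → Lab → Lab
  rvacAux zero π = upper 0 π
  rvacAux (suc m) π = upper (suc m) (rvacAux m π)

  rvac : Lab → Lab
  rvac = rvacAux r

module _ (S : Semifield) (P : FinPoset) (r : ℕ) (rk : Fin (FinPoset.n P) → ℕ)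
         (κ : Semifield.Carrier S) where
  open FinPoset P

  private
    module TP  = Toggles S n le (λ _ → true) rk r κ
    module TP1 = Toggles S n le (λ p → 1 ≤ᵇ rk p) (λ p → rk p ∸ 1) (r ∸ 1) κ

  rvacP : (Fin n → Semifield.Carrier S) → Fin n → Semifield.Carrier S
  rvacP = TP.rvac

  τ₀P : (Fin n → Semifield.Carrier S) → Fin n → Semifield.Carrier S
  τ₀P = TP.τrank 0

  -- operators for P_{≥1} (labelings of P restricted to P_{≥1}: only values on
  -- elements of rank ≥ 1 are read)
  rowmotionP≥1 : (Fin n → Semifield.Carrier S) → Fin n → Semifield.Carrier S
  rowmotionP≥1 = TP1.rowmotion

  rvacP≥1 : (Fin n → Semifield.Carrier S) → Fin n → Semifield.Carrier S
  rvacP≥1 = TP1.rvac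

{-# OPTIONS --safe #-}
module Submission where

-- Write D μ p and U μ p for the sums of ∏ μ over the maximal chains of the poset below p
-- (ending at p) and strictly above p, and W μ p = μ p · U μ p. Every maximal chain through p
-- splits at p, so the chain sum in the toggle at p is D μ p · U μ p. Toggling the ranks
-- j, …, r in turn therefore produces a labelling whose D-values at ranks ≥ j are κ / W μ, and a
-- labelling is recovered both from its D-values (μ y = D y / Σ_{q ⋖ y} D q) and from its
-- W-values (μ y = W y / U y). At rank 0 only the first factor of rvac moves x, and only through
-- τ₀. At rank ≥ 1, U and W computed in P and in P≥1 agree; comparing the D-values of
-- ρ σ = rvac π in P≥1 with the intermediate stages of rvac in P shows that σ and rvac π have the
-- same W-values on P≥1, hence the same values.

open import Defs
open import Algebra.Bundles using (AbelianGroup)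
import Algebra.Properties.AbelianGroup as AbelianGroupProperties
import Algebra.Solver.CommutativeMonoid as CommutativeMonoidSolver
open import Data.Bool using (Bool; true; false; if_then_else_; _∧_; _∨_; not; T)
open import Data.Bool.Properties using (∧-zeroʳ; T-∧; T-∨; T-≡; T-not-≡; ¬-not)
open import Data.Empty using (⊥; ⊥-elim)
open import Data.Fin using (Fin; zero; suc)
open import Data.Fin.Properties using (any?) renaming (_≟_ to _≟ᶠ_)
import Data.Fin.Properties as Finₚ
open import Data.Fin.Subset using (Subset; ∣_∣; _⊂_) renaming (_∈_ to _∈ₛ_)
open import Data.Fin.Subset.Properties using (p⊂q⇒∣p∣<∣q∣)
open import Data.List using (List; []; _∷_; map; foldr; filter; filterᵇ; allFin; concatMap)
import Data.List.Extrema as Extrema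
open import Data.List.Membership.Propositional using (_∈_)
open import Data.List.Membership.Propositional.Properties using (∈-allFin; ∈-filter⁺; ∈-filter⁻)
open import Data.List.Properties using (map-tabulate; foldr-map; map-cong-local)
import Data.List.Relation.Unary.All as All
open import Data.List.Relation.Unary.All.Properties using (all-filter)
open import Data.List.Relation.Unary.AllPairs using ([]; _∷_)
open import Data.List.Relation.Unary.Any using (here; there)
open import Data.List.Relation.Unary.Unique.Propositional using (Unique)
open import Data.List.Relation.Unary.Unique.Propositional.Properties using (allFin⁺)
open import Data.Maybe using (Maybe; just; nothing)
open import Data.Nat as ℕ using (ℕ; zero; suc; _<_; _≤_; _∸_; z≤n; s≤s; _≡ᵇ_; _≤ᵇ_)
open import Data.Nat.Induction using (<-wellFounded)
import Data.Nat.Properties as ℕₚ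
open import Data.Product using (_×_; _,_; proj₁; proj₂; Σ; ∃-syntax)
open import Data.Sum using (_⊎_; inj₁; inj₂)
open import Data.Unit using (tt)
open import Data.Vec using (Vec; []; _∷_; lookup; replicate; zipWith; _[_]≔_) renaming (tabulate to tabulateᵛ)
open import Data.Vec.Properties using (lookup-zipWith; lookup∘tabulate; lookup∘update; lookup∘update′; []≔-idempotent; []≔-lookup; []=⇒lookup; lookup⇒[]=)
open import Function using (_∘_; case_of_; Equivalence)
open import Induction.WellFounded using (acc; Acc)
open import Relation.Binary.PropositionalEquality
open import Relation.Nullary using (Dec; yes; no; does; ¬_; T?)
open import Relation.Nullary.Decidable using (toSum)
open ≡-Reasoning

module SemifieldProperties (S : Semifield) where
  open Semifield S public

  *-identityʳ : ∀ x → x * 1# ≡ x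
  *-identityʳ x = trans (*-comm x 1#) (*-identityˡ x)

  *-abelianGroup : AbelianGroup _ _
  *-abelianGroup = record
    { Carrier = Carrier ; _≈_ = _≡_ ; _∙_ = _*_ ; ε = 1# ; _⁻¹ = _⁻¹
    ; isAbelianGroup = record
      { isGroup = record
        { isMonoid = record
          { isSemigroup = record
            { isMagma = record { isEquivalence = isEquivalence ; ∙-cong = cong₂ _*_ }
            ; assoc = *-assoc }
          ; identity = *-identityˡ , *-identityʳ }
        ; inverse = (λ x → trans (*-comm _ x) (*-inverseʳ x)) , *-inverseʳ
        ; ⁻¹-cong = cong _⁻¹ }
      ; comm = *-comm } }

  open AbelianGroupProperties *-abelianGroup public
    using (⁻¹-involutive; ⁻¹-∙-comm; ∙-cancelˡ)
  open CommutativeMonoidSolver (AbelianGroup.commutativeMonoid *-abelianGroup)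
    using (solve; _⊜_) renaming (_⊕_ to _·_)

  -- The sum of a list that is nonempty in every use below; the junk value 1# is never reached.
  ∑⁺ : List Carrier → Carrier
  ∑⁺ [] = 1#
  ∑⁺ (x ∷ []) = x
  ∑⁺ (x ∷ y ∷ l) = x + ∑⁺ (y ∷ l)

  *-lcomm : ∀ x y z → x * (y * z) ≡ y * (x * z)
  *-lcomm = solve 3 (λ x y z → (x · (y · z)) ⊜ (y · (x · z))) refl

  ⁻¹-distrib-* : ∀ x y → (x * y) ⁻¹ ≡ (x ⁻¹) * (y ⁻¹)
  ⁻¹-distrib-* x y = sym (⁻¹-∙-comm x y)

  x*y*y⁻¹≡x : ∀ x y → (x * y) * (y ⁻¹) ≡ x
  x*y*y⁻¹≡x x y = trans (*-assoc x y (y ⁻¹)) (trans (cong (x *_) (*-inverseʳ y)) (*-identityʳ x))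

  *⁻¹-injective : ∀ c {x y} → c * (x ⁻¹) ≡ c * (y ⁻¹) → x ≡ y
  *⁻¹-injective c {x} {y} e =
    trans (sym (⁻¹-involutive x)) (trans (cong _⁻¹ (∙-cancelˡ c _ _ e)) (⁻¹-involutive y))

  *⁻¹-involutive : ∀ c x → c * ((c * (x ⁻¹)) ⁻¹) ≡ x
  *⁻¹-involutive c x = begin
    c * ((c * (x ⁻¹)) ⁻¹)          ≡⟨ cong (c *_) (⁻¹-distrib-* c (x ⁻¹)) ⟩
    c * ((c ⁻¹) * ((x ⁻¹) ⁻¹))     ≡⟨ cong (λ t → c * ((c ⁻¹) * t)) (⁻¹-involutive x) ⟩
    c * ((c ⁻¹) * x)               ≡⟨ sym (*-assoc c (c ⁻¹) x) ⟩
    (c * (c ⁻¹)) * x               ≡⟨ cong (_* x) (*-inverseʳ c) ⟩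
    1# * x                         ≡⟨ *-identityˡ x ⟩
    x                              ∎

  -- t ↦ ((c / t) / b) · u is the involution t ↦ K / t with K = (c / b) · u.
  rescaled-⁻¹-involutive : ∀ c b u t → (((c * ((((c * (t ⁻¹)) * (b ⁻¹)) * u) ⁻¹)) * (b ⁻¹)) * u) ≡ t
  rescaled-⁻¹-involutive c b u t = begin
    ((c * ((((c * (t ⁻¹)) * (b ⁻¹)) * u) ⁻¹)) * (b ⁻¹)) * u  ≡⟨ rescale _ ⟩
    K * ((((c * (t ⁻¹)) * (b ⁻¹)) * u) ⁻¹)                  ≡⟨ cong (λ w → K * (w ⁻¹)) (rescale t) ⟩
    K * ((K * (t ⁻¹)) ⁻¹)                                    ≡⟨ *⁻¹-involutive K t ⟩
    t                                                        ∎
    where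
      K = (c * (b ⁻¹)) * u
      rescale : ∀ w → ((c * (w ⁻¹)) * (b ⁻¹)) * u ≡ K * (w ⁻¹)
      rescale w = solve 4 (λ c w⁻ b⁻ u → (((c · w⁻) · b⁻) · u) ⊜ (((c · b⁻) · u) · w⁻)) refl c (w ⁻¹) (b ⁻¹) u

  *⁻¹-absorb : ∀ c a s u → (c * (((a * s) * u) ⁻¹)) * s ≡ c * ((a * u) ⁻¹)
  *⁻¹-absorb c a s u = begin
    (c * (((a * s) * u) ⁻¹)) * s
      ≡⟨ cong (λ t → (c * (t ⁻¹)) * s) (solve 3 (λ a s u → ((a · s) · u) ⊜ ((a · u) · s)) refl a s u) ⟩
    (c * (((a * u) * s) ⁻¹)) * s
      ≡⟨ cong (λ t → (c * t) * s) (⁻¹-distrib-* (a * u) s) ⟩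
    (c * (((a * u) ⁻¹) * (s ⁻¹))) * s
      ≡⟨ solve 4 (λ c w s⁻ s → ((c · (w · s⁻)) · s) ⊜ ((c · w) · (s · s⁻))) refl c ((a * u) ⁻¹) (s ⁻¹) s ⟩
    (c * ((a * u) ⁻¹)) * (s * (s ⁻¹))
      ≡⟨ trans (cong ((c * ((a * u) ⁻¹)) *_) (*-inverseʳ s)) (*-identityʳ _) ⟩
    c * ((a * u) ⁻¹) ∎

T-∧-intro : ∀ {a b} → T a → T b → T (a ∧ b)
T-∧-intro ta tb = Equivalence.from T-∧ (ta , tb)

T-∧ˡ : ∀ {a b} → T (a ∧ b) → T a
T-∧ˡ = proj₁ ∘ Equivalence.to T-∧

T-∧ʳ : ∀ {a b} → T (a ∧ b) → T b
T-∧ʳ = proj₂ ∘ Equivalence.to T-∧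

T-∨ˡ : ∀ {a b} → T a → T (a ∨ b)
T-∨ˡ = Equivalence.from T-∨ ∘ inj₁

T-∨ʳ : ∀ {a b} → T b → T (a ∨ b)
T-∨ʳ = Equivalence.from T-∨ ∘ inj₂

T-∨-elim : ∀ {a b} → T (a ∨ b) → T a ⊎ T b
T-∨-elim = Equivalence.to T-∨

T-dec : ∀ b → T b ⊎ ¬ T b
T-dec b = toSum (T? b)

T-≡true : ∀ {b} → T b → b ≡ true
T-≡true = Equivalence.to T-≡

¬T-≡false : ∀ {b} → ¬ T b → b ≡ false
¬T-≡false ¬tb = ¬-not (¬tb ∘ Equivalence.from T-≡)

T-not-intro : ∀ {a} → ¬ T a → T (not a)
T-not-intro = Equivalence.from T-not-≡ ∘ ¬T-≡false

T-not-elim : ∀ {a} → T (not a) → ¬ T a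
T-not-elim t ta = subst T (Equivalence.to T-not-≡ t) ta

T-ext : ∀ {a b} → (T a → T b) → (T b → T a) → a ≡ b
T-ext {true} {true} f g = refl
T-ext {true} {false} f g = ⊥-elim (f tt)
T-ext {false} {true} f g = ⊥-elim (g tt)
T-ext {false} {false} f g = refl

eqF-refl : ∀ {n} (p : Fin n) → T (eqF p p)
eqF-refl p with p ≟ᶠ p
... | yes _ = tt
... | no p≢p = p≢p refl

eqF-sound : ∀ {n} {p q : Fin n} → T (eqF p q) → p ≡ q
eqF-sound {p = p} {q} t with p ≟ᶠ q
... | yes e = e

foldr-allFin-suc : ∀ {B : Set} {n} (g : Fin (suc n) → B → B) e →
  foldr g e (allFin (suc n)) ≡ g zero (foldr (λ i → g (suc i)) e (allFin n))
foldr-allFin-suc {n = n} g e =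
  cong (g zero) (trans (cong (foldr g e) (sym (map-tabulate (λ i → i) suc))) (foldr-map g suc e (allFin n)))

allB-intro : ∀ {n} (f : Fin n → Bool) → (∀ p → T (f p)) → T (allB f)
allB-intro {zero} f h = tt
allB-intro {suc n} f h = subst T (sym (foldr-allFin-suc (λ p b → f p ∧ b) true))
  (T-∧-intro (h zero) (allB-intro (λ i → f (suc i)) (λ i → h (suc i))))

allB-elim : ∀ {n} (f : Fin n → Bool) → T (allB f) → ∀ p → T (f p)
allB-elim {suc n} f t zero = T-∧ˡ (subst T (foldr-allFin-suc (λ p b → f p ∧ b) true) t)
allB-elim {suc n} f t (suc p) =
  allB-elim (λ i → f (suc i)) (T-∧ʳ {f zero} (subst T (foldr-allFin-suc (λ p b → f p ∧ b) true) t)) p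

search : ∀ {n} (φ : Fin n → Bool) → (Σ (Fin n) λ x → T (φ x)) ⊎ (∀ x → ¬ T (φ x))
search φ with any? (T? ∘ φ)
... | yes (x , t) = inj₁ (x , t)
... | no f = inj₂ (λ x t → f (x , t))

module _ {n : ℕ} (φ : Fin n → Bool) (f : Fin n → ℕ) where
  private
    open Extrema ℕₚ.≤-totalOrder
    candidates = filterᵇ φ (allFin n)

    candidate : ∀ {y} → T (φ y) → y ∈ candidates
    candidate φy = ∈-filter⁺ (T? ∘ φ) (∈-allFin _) φy

  argmaxᵇ : ∀ w → T (φ w) → Σ (Fin n) λ x → T (φ x) × (∀ y → T (φ y) → f y ≤ f x)
  argmaxᵇ w φw = argmax f w candidates
               , argmax-all f φw (all-filter (T? ∘ φ) (allFin n))
               , λ y φy → All.lookup (f[xs]≤f[argmax] w candidates) (candidate φy)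

  argminᵇ : ∀ w → T (φ w) → Σ (Fin n) λ x → T (φ x) × (∀ y → T (φ y) → f x ≤ f y)
  argminᵇ w φw = argmin f w candidates
               , argmin-all f φw (all-filter (T? ∘ φ) (allFin n))
               , λ y φy → All.lookup (f[argmin]≤f[xs] w candidates) (candidate φy)

_∩_ : ∀ {n} → Vec Bool n → Vec Bool n → Vec Bool n
_∩_ = zipWith _∧_

_∖_ : ∀ {n} → Vec Bool n → Vec Bool n → Vec Bool n
_∖_ = zipWith (λ x m → x ∧ not m)

_⊆ᵇ_ : ∀ {n} → Vec Bool n → Vec Bool n → Bool
[] ⊆ᵇ [] = true
(true ∷ X) ⊆ᵇ (m ∷ M) = m ∧ (X ⊆ᵇ M)
(false ∷ X) ⊆ᵇ (m ∷ M) = X ⊆ᵇ M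

disjointᵇ : ∀ {n} → Vec Bool n → Vec Bool n → Bool
disjointᵇ [] [] = true
disjointᵇ (true ∷ X) (m ∷ M) = not m ∧ disjointᵇ X M
disjointᵇ (false ∷ X) (m ∷ M) = disjointᵇ X M

emptyᵇ : ∀ {n} → Vec Bool n → Bool
emptyᵇ [] = true
emptyᵇ (true ∷ X) = false
emptyᵇ (false ∷ X) = emptyᵇ X

⊆ᵇ-intro : ∀ {n} (Y M : Vec Bool n) → (∀ y → T (lookup Y y) → T (lookup M y)) → T (Y ⊆ᵇ M)
⊆ᵇ-intro [] [] h = tt
⊆ᵇ-intro (true ∷ Y) (m ∷ M) h = T-∧-intro (h zero tt) (⊆ᵇ-intro Y M (λ y → h (suc y)))
⊆ᵇ-intro (false ∷ Y) (m ∷ M) h = ⊆ᵇ-intro Y M (λ y → h (suc y))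

disjointᵇ-intro : ∀ {n} (Y M : Vec Bool n) → (∀ y → T (lookup Y y) → ¬ T (lookup M y)) → T (disjointᵇ Y M)
disjointᵇ-intro [] [] h = tt
disjointᵇ-intro (true ∷ Y) (m ∷ M) h = T-∧-intro (T-not-intro (h zero tt)) (disjointᵇ-intro Y M (λ y → h (suc y)))
disjointᵇ-intro (false ∷ Y) (m ∷ M) h = disjointᵇ-intro Y M (λ y → h (suc y))

emptyᵇ-intro : ∀ {n} (Y : Vec Bool n) → (∀ y → ¬ T (lookup Y y)) → T (emptyᵇ Y)
emptyᵇ-intro [] h = tt
emptyᵇ-intro (true ∷ Y) h = h zero tt
emptyᵇ-intro (false ∷ Y) h = emptyᵇ-intro Y (λ y → h (suc y))

emptyᵇ-elim : ∀ {n} (Y : Vec Bool n) → T (emptyᵇ Y) → ∀ y → ¬ T (lookup Y y)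
emptyᵇ-elim (false ∷ Y) t zero ()
emptyᵇ-elim (false ∷ Y) t (suc y) = emptyᵇ-elim Y t y

module _ {n : ℕ} where

  insert-∈ : ∀ (X : Vec Bool n) p → T (lookup (X [ p ]≔ true) p)
  insert-∈ X p = subst T (sym (lookup∘update p X true)) tt

  update-∈⁺ : ∀ (X : Vec Bool n) b {p y} → ¬ y ≡ p → T (lookup X y) → T (lookup (X [ p ]≔ b) y)
  update-∈⁺ X b y≢p t = subst T (sym (lookup∘update′ y≢p X b)) t

  update-∈⁻ : ∀ (X : Vec Bool n) b {p y} → ¬ y ≡ p → T (lookup (X [ p ]≔ b) y) → T (lookup X y)
  update-∈⁻ X b y≢p t = subst T (lookup∘update′ y≢p X b) t

  insert-∈⁻ : ∀ (X : Vec Bool n) p y → T (lookup (X [ p ]≔ true) y) → y ≡ p ⊎ (¬ y ≡ p × T (lookup X y))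
  insert-∈⁻ X p y t with y ≟ᶠ p
  ... | yes e = inj₁ e
  ... | no y≢p = inj₂ (y≢p , update-∈⁻ X true y≢p t)

  remove-∈⁻ : ∀ (X : Vec Bool n) p y → T (lookup (X [ p ]≔ false) y) → ¬ y ≡ p × T (lookup X y)
  remove-∈⁻ X p y t with y ≟ᶠ p
  ... | yes refl = ⊥-elim (subst T (lookup∘update p X false) t)
  ... | no y≢p = y≢p , update-∈⁻ X false y≢p t

  ∉⇒≢ : ∀ (X : Vec Bool n) {p y} → ¬ T (lookup X p) → T (lookup X y) → ¬ y ≡ p
  ∉⇒≢ X p∉X y∈X refl = p∉X y∈X

  insert-remove : ∀ (X : Vec Bool n) p b → lookup X p ≡ false → (X [ p ]≔ b) [ p ]≔ false ≡ X
  insert-remove X p b e = trans ([]≔-idempotent X p) (trans (cong (X [ p ]≔_) (sym e)) ([]≔-lookup X p))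

-- Adjoining a zero (nothing) turns the semifield into a commutative semiring, so that sums
-- over possibly empty families of chains can be manipulated before knowing they are nonempty.
module ZeroAdjoined (S : Semifield) where
  open SemifieldProperties S

  Carrier₀ : Set
  Carrier₀ = Maybe Carrier

  infixl 6 _⊕_
  infixl 7 _⊗_

  _⊕_ : Carrier₀ → Carrier₀ → Carrier₀
  nothing ⊕ m = m
  just x ⊕ nothing = just x
  just x ⊕ just y = just (x + y)

  _⊗_ : Carrier₀ → Carrier₀ → Carrier₀
  nothing ⊗ _ = nothing
  just x ⊗ nothing = nothing
  just x ⊗ just y = just (x * y)

  ⊕-identityʳ : ∀ a → a ⊕ nothing ≡ a
  ⊕-identityʳ nothing = refl
  ⊕-identityʳ (just x) = refl

  ⊕-assoc : ∀ a b c → (a ⊕ b) ⊕ c ≡ a ⊕ (b ⊕ c)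
  ⊕-assoc nothing b c = refl
  ⊕-assoc (just x) nothing c = refl
  ⊕-assoc (just x) (just y) nothing = refl
  ⊕-assoc (just x) (just y) (just z) = cong just (+-assoc x y z)

  ⊕-comm : ∀ a b → a ⊕ b ≡ b ⊕ a
  ⊕-comm nothing b = sym (⊕-identityʳ b)
  ⊕-comm (just x) nothing = refl
  ⊕-comm (just x) (just y) = cong just (+-comm x y)

  ⊕-interchange : ∀ a b c d → (a ⊕ b) ⊕ (c ⊕ d) ≡ (a ⊕ c) ⊕ (b ⊕ d)
  ⊕-interchange a b c d = begin
    (a ⊕ b) ⊕ (c ⊕ d)  ≡⟨ ⊕-assoc a b _ ⟩
    a ⊕ (b ⊕ (c ⊕ d))  ≡⟨ cong (a ⊕_) (sym (⊕-assoc b c d)) ⟩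
    a ⊕ ((b ⊕ c) ⊕ d)  ≡⟨ cong (λ t → a ⊕ (t ⊕ d)) (⊕-comm b c) ⟩
    a ⊕ ((c ⊕ b) ⊕ d)  ≡⟨ cong (a ⊕_) (⊕-assoc c b d) ⟩
    a ⊕ (c ⊕ (b ⊕ d))  ≡⟨ sym (⊕-assoc a c _) ⟩
    (a ⊕ c) ⊕ (b ⊕ d)  ∎

  ⊗-zeroʳ : ∀ a → a ⊗ nothing ≡ nothing
  ⊗-zeroʳ nothing = refl
  ⊗-zeroʳ (just x) = refl

  ⊗-comm : ∀ a b → a ⊗ b ≡ b ⊗ a
  ⊗-comm nothing b = sym (⊗-zeroʳ b)
  ⊗-comm (just x) nothing = refl
  ⊗-comm (just x) (just y) = cong just (*-comm x y)

  ⊗-distribˡ : ∀ a b c → a ⊗ (b ⊕ c) ≡ a ⊗ b ⊕ a ⊗ c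
  ⊗-distribˡ nothing b c = refl
  ⊗-distribˡ (just x) nothing c = refl
  ⊗-distribˡ (just x) (just y) nothing = refl
  ⊗-distribˡ (just x) (just y) (just z) = cong just (distribˡ x y z)

  ⊗-distribʳ : ∀ a b c → (b ⊕ c) ⊗ a ≡ b ⊗ a ⊕ c ⊗ a
  ⊗-distribʳ a b c = trans (⊗-comm _ a) (trans (⊗-distribˡ a b c) (cong₂ _⊕_ (⊗-comm a b) (⊗-comm a c)))

  ⁅_⁆_ : Bool → Carrier₀ → Carrier₀
  ⁅ true ⁆ m = m
  ⁅ false ⁆ m = nothing

  ⁅∧⁆ : ∀ a b m → ⁅ a ∧ b ⁆ m ≡ ⁅ a ⁆ (⁅ b ⁆ m)
  ⁅∧⁆ true b m = refl
  ⁅∧⁆ false b m = refl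

  ⁅∧⁆-⊗ : ∀ a b x y → ⁅ a ∧ b ⁆ (x ⊗ y) ≡ ⁅ a ⁆ x ⊗ ⁅ b ⁆ y
  ⁅∧⁆-⊗ true true x y = refl
  ⁅∧⁆-⊗ true false x y = sym (⊗-zeroʳ x)
  ⁅∧⁆-⊗ false b x y = refl

  ⁅⁆-⊗ : ∀ b x y → ⁅ b ⁆ (x ⊗ y) ≡ x ⊗ ⁅ b ⁆ y
  ⁅⁆-⊗ true x y = refl
  ⁅⁆-⊗ false x y = sym (⊗-zeroʳ x)

  ⁅⁆-absorb : ∀ a b m → (T b → T a) → ⁅ a ⁆ (⁅ b ⁆ m) ≡ ⁅ b ⁆ m
  ⁅⁆-absorb true b m h = refl
  ⁅⁆-absorb false true m h = ⊥-elim (h tt)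
  ⁅⁆-absorb false false m h = refl

  ⁅false⁆ : ∀ b m → ¬ T b → ⁅ b ⁆ m ≡ nothing
  ⁅false⁆ b m h = cong (⁅_⁆ m) (¬T-≡false h)

  ∑ : {A : Set} → List A → (A → Carrier₀) → Carrier₀
  ∑ l F = foldr (λ q acc → F q ⊕ acc) nothing l

  ∑-cong : {A : Set} (l : List A) {F G : A → Carrier₀} → (∀ x → x ∈ l → F x ≡ G x) → ∑ l F ≡ ∑ l G
  ∑-cong [] e = refl
  ∑-cong (x ∷ l) e = cong₂ _⊕_ (e x (here refl)) (∑-cong l (λ y m → e y (there m)))

  ∑-⊕ : {A : Set} (l : List A) (F G : A → Carrier₀) → ∑ l (λ q → F q ⊕ G q) ≡ ∑ l F ⊕ ∑ l G
  ∑-⊕ [] F G = refl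
  ∑-⊕ (x ∷ l) F G = trans (cong (F x ⊕ G x ⊕_) (∑-⊕ l F G)) (⊕-interchange (F x) (G x) _ _)

  ∑-zero : {A : Set} (l : List A) {F : A → Carrier₀} → (∀ q → F q ≡ nothing) → ∑ l F ≡ nothing
  ∑-zero [] h = refl
  ∑-zero (x ∷ l) {F} h = trans (cong (_⊕ ∑ l F) (h x)) (∑-zero l h)

  ⊗-∑ : {A : Set} (a : Carrier₀) (l : List A) (F : A → Carrier₀) → a ⊗ ∑ l F ≡ ∑ l (λ q → a ⊗ F q)
  ⊗-∑ a [] F = ⊗-zeroʳ a
  ⊗-∑ a (x ∷ l) F = trans (⊗-distribˡ a (F x) _) (cong (a ⊗ F x ⊕_) (⊗-∑ a l F))

  ∑-swap : {A B : Set} (l : List A) (k : List B) (F : A → B → Carrier₀) →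
           ∑ l (λ a → ∑ k (F a)) ≡ ∑ k (λ b → ∑ l (λ a → F a b))
  ∑-swap [] k F = sym (∑-zero k (λ _ → refl))
  ∑-swap (x ∷ l) k F = trans (cong (∑ k (F x) ⊕_) (∑-swap l k F)) (sym (∑-⊕ k (F x) (λ b → ∑ l (λ a → F a b))))

  ∑-filterᵇ : {A : Set} (c : A → Bool) (l : List A) (F : A → Carrier₀) → ∑ (filterᵇ c l) F ≡ ∑ l (λ q → ⁅ c q ⁆ F q)
  ∑-filterᵇ c [] F = refl
  ∑-filterᵇ c (x ∷ l) F with c x
  ... | true = cong (F x ⊕_) (∑-filterᵇ c l F)
  ... | false = ∑-filterᵇ c l F

  ∑-allFin-suc : ∀ {n} (F : Fin (suc n) → Carrier₀) → ∑ (allFin (suc n)) F ≡ F zero ⊕ ∑ (allFin n) (λ q → F (suc q))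
  ∑-allFin-suc F = foldr-allFin-suc (λ q acc → F q ⊕ acc) nothing

  ∑-indicator-unique : ∀ {n} (b : Bool) (ψ : Fin n → Bool) (m : Carrier₀) →
    (∀ q q′ → T (ψ q) → T (ψ q′) → q ≡ q′) → (T b → ∃[ q ] T (ψ q)) → (∀ q → T (ψ q) → T b) →
    ⁅ b ⁆ m ≡ ∑ (allFin n) (λ q → ⁅ ψ q ⁆ m)
  ∑-indicator-unique {zero} false ψ m _ _ _ = refl
  ∑-indicator-unique {zero} true ψ m _ witness _ with witness tt
  ... | () , _
  ∑-indicator-unique {suc n} b ψ m unique witness sound with T-dec (ψ zero)
  ... | inj₁ ψ0 = begin
    ⁅ b ⁆ m                                              ≡⟨ cong (⁅_⁆ m) (T-≡true (sound zero ψ0)) ⟩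
    m                                                    ≡⟨ sym (⊕-identityʳ m) ⟩
    m ⊕ nothing                                          ≡⟨ sym (cong₂ _⊕_ (cong (⁅_⁆ m) (T-≡true ψ0)) (∑-zero (allFin n) rest)) ⟩
    ⁅ ψ zero ⁆ m ⊕ ∑ (allFin n) (λ q → ⁅ ψ (suc q) ⁆ m) ≡⟨ sym (∑-allFin-suc (λ q → ⁅ ψ q ⁆ m)) ⟩
    ∑ (allFin (suc n)) (λ q → ⁅ ψ q ⁆ m)                 ∎
    where
      rest : ∀ q → ⁅ ψ (suc q) ⁆ m ≡ nothing
      rest q = ⁅false⁆ (ψ (suc q)) m (λ ψq → case unique zero (suc q) ψ0 ψq of λ ())
  ... | inj₂ ¬ψ0 = trans
    (∑-indicator-unique b (ψ ∘ suc) m (λ q q′ t t′ → Finₚ.suc-injective (unique _ _ t t′)) witness′ (sound ∘ suc))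
    (sym (trans (∑-allFin-suc (λ q → ⁅ ψ q ⁆ m)) (cong (_⊕ ∑ (allFin n) (λ q → ⁅ ψ (suc q) ⁆ m)) (⁅false⁆ (ψ zero) m ¬ψ0))))
    where
      witness′ : T b → ∃[ q ] T (ψ (suc q))
      witness′ tb with witness tb
      ... | zero , t = ⊥-elim (¬ψ0 t)
      ... | suc q , t = q , t

  ∑-just : {A : Set} (l : List A) (f : A → Carrier) → (∃[ q ] q ∈ l) → ∑ l (λ q → just (f q)) ≡ just (∑⁺ (map f l))
  ∑-just (x ∷ []) f _ = refl
  ∑-just (x ∷ y ∷ l) f _ = cong (just (f x) ⊕_) (∑-just (y ∷ l) f (y , here refl))

  ∑ₛ : {n : ℕ} → (Vec Bool n → Carrier₀) → Carrier₀
  ∑ₛ {n} F = ∑ (allSubsets n) F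

  ∑ₛ-cong : ∀ {n} {F G : Vec Bool n → Carrier₀} → (∀ X → F X ≡ G X) → ∑ₛ F ≡ ∑ₛ G
  ∑ₛ-cong {n} e = ∑-cong (allSubsets n) (λ X _ → e X)

  ∑ₛ-⊕ : ∀ {n} (F G : Vec Bool n → Carrier₀) → ∑ₛ (λ X → F X ⊕ G X) ≡ ∑ₛ F ⊕ ∑ₛ G
  ∑ₛ-⊕ {n} = ∑-⊕ (allSubsets n)

  ⊗-∑ₛ : ∀ {n} (a : Carrier₀) (F : Vec Bool n → Carrier₀) → a ⊗ ∑ₛ F ≡ ∑ₛ (λ X → a ⊗ F X)
  ⊗-∑ₛ {n} a = ⊗-∑ a (allSubsets n)

  ∑ₛ-⁅⁆ : ∀ {n} c (G : Vec Bool n → Carrier₀) → ∑ₛ (λ X → ⁅ c ⁆ G X) ≡ ⁅ c ⁆ ∑ₛ G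
  ∑ₛ-⁅⁆ true G = refl
  ∑ₛ-⁅⁆ {n} false G = ∑-zero (allSubsets n) (λ _ → refl)

  ∑ₛ-suc : ∀ {n} (F : Vec Bool (suc n) → Carrier₀) → ∑ₛ F ≡ ∑ₛ {n} (λ v → F (true ∷ v) ⊕ F (false ∷ v))
  ∑ₛ-suc {n} F = go (allSubsets n)
    where
      go : ∀ L → ∑ (concatMap (λ v → (true ∷ v) ∷ (false ∷ v) ∷ []) L) F ≡ ∑ L (λ v → F (true ∷ v) ⊕ F (false ∷ v))
      go [] = refl
      go (v ∷ L) = trans (cong (λ t → F (true ∷ v) ⊕ (F (false ∷ v) ⊕ t)) (go L)) (sym (⊕-assoc (F (true ∷ v)) _ _))

  ∑ₛ-empty : ∀ {n} (F : Vec Bool n → Carrier₀) → ∑ₛ (λ X → ⁅ emptyᵇ X ⁆ F X) ≡ F (replicate n false)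
  ∑ₛ-empty {zero} F = ⊕-identityʳ (F [])
  ∑ₛ-empty {suc n} F = trans (∑ₛ-suc (λ X → ⁅ emptyᵇ X ⁆ F X)) (∑ₛ-empty (λ v → F (false ∷ v)))

  ∑ₛ-pivot : ∀ {n} (p : Fin n) (F : Vec Bool n → Carrier₀) →
    ∑ₛ F ≡ ∑ₛ (λ X → ⁅ not (lookup X p) ⁆ (F X ⊕ F (X [ p ]≔ true)))
  ∑ₛ-pivot {suc n} zero F = begin
    ∑ₛ F                                          ≡⟨ ∑ₛ-suc F ⟩
    ∑ₛ (λ v → F (true ∷ v) ⊕ F (false ∷ v))       ≡⟨ ∑ₛ-cong (λ v → ⊕-comm (F (true ∷ v)) (F (false ∷ v))) ⟩
    ∑ₛ (λ v → F (false ∷ v) ⊕ F (true ∷ v))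
      ≡⟨ sym (∑ₛ-suc (λ X → ⁅ not (lookup X zero) ⁆ (F X ⊕ F (X [ zero ]≔ true)))) ⟩
    ∑ₛ (λ X → ⁅ not (lookup X zero) ⁆ (F X ⊕ F (X [ zero ]≔ true))) ∎
  ∑ₛ-pivot {suc n} (suc p) F = begin
    ∑ₛ F                                          ≡⟨ ∑ₛ-suc F ⟩
    ∑ₛ (λ v → F (true ∷ v) ⊕ F (false ∷ v))       ≡⟨ ∑ₛ-⊕ (λ v → F (true ∷ v)) (λ v → F (false ∷ v)) ⟩
    ∑ₛ (λ v → F (true ∷ v)) ⊕ ∑ₛ (λ v → F (false ∷ v))
      ≡⟨ cong₂ _⊕_ (∑ₛ-pivot p (λ v → F (true ∷ v))) (∑ₛ-pivot p (λ v → F (false ∷ v))) ⟩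
    ∑ₛ (G true) ⊕ ∑ₛ (G false)                    ≡⟨ sym (∑ₛ-⊕ (G true) (G false)) ⟩
    ∑ₛ (λ v → G true v ⊕ G false v)
      ≡⟨ sym (∑ₛ-suc (λ X → ⁅ not (lookup X (suc p)) ⁆ (F X ⊕ F (X [ suc p ]≔ true)))) ⟩
    ∑ₛ (λ X → ⁅ not (lookup X (suc p)) ⁆ (F X ⊕ F (X [ suc p ]≔ true))) ∎
    where
      G : Bool → Vec Bool n → Carrier₀
      G b v = ⁅ not (lookup v p) ⁆ (F (b ∷ v) ⊕ F (b ∷ (v [ p ]≔ true)))

  ∑ₛ-split : ∀ {n} (M : Vec Bool n) (F G : Vec Bool n → Carrier₀) →
    ∑ₛ (λ X → F (X ∩ M) ⊗ G (X ∖ M)) ≡ ∑ₛ (λ Y → ⁅ Y ⊆ᵇ M ⁆ F Y) ⊗ ∑ₛ (λ Z → ⁅ disjointᵇ Z M ⁆ G Z)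
  ∑ₛ-split {zero} [] F G = trans (⊕-identityʳ _) (sym (cong₂ _⊗_ (⊕-identityʳ (F [])) (⊕-identityʳ (G []))))
  ∑ₛ-split {suc n} (true ∷ M) F G = begin
    ∑ₛ (λ X → F (X ∩ (true ∷ M)) ⊗ G (X ∖ (true ∷ M)))
      ≡⟨ trans (∑ₛ-suc (λ X → F (X ∩ (true ∷ M)) ⊗ G (X ∖ (true ∷ M))))
               (∑ₛ-⊕ (λ v → F (true ∷ (v ∩ M)) ⊗ G (false ∷ (v ∖ M))) (λ v → F (false ∷ (v ∩ M)) ⊗ G (false ∷ (v ∖ M)))) ⟩
    ∑ₛ (λ v → F (true ∷ (v ∩ M)) ⊗ G (false ∷ (v ∖ M))) ⊕ ∑ₛ (λ v → F (false ∷ (v ∩ M)) ⊗ G (false ∷ (v ∖ M)))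
      ≡⟨ cong₂ _⊕_ (∑ₛ-split M (F ∘ (true ∷_)) (G ∘ (false ∷_))) (∑ₛ-split M (F ∘ (false ∷_)) (G ∘ (false ∷_))) ⟩
    Fs true ⊗ Gs false ⊕ Fs false ⊗ Gs false
      ≡⟨ sym (⊗-distribʳ (Gs false) (Fs true) (Fs false)) ⟩
    (Fs true ⊕ Fs false) ⊗ Gs false
      ≡⟨ cong₂ _⊗_ (trans (sym (∑ₛ-⊕ (λ Y → ⁅ Y ⊆ᵇ M ⁆ F (true ∷ Y)) (λ Y → ⁅ Y ⊆ᵇ M ⁆ F (false ∷ Y))))
                          (sym (∑ₛ-suc (λ Y → ⁅ Y ⊆ᵇ (true ∷ M) ⁆ F Y))))
                   (sym (∑ₛ-suc (λ Z → ⁅ disjointᵇ Z (true ∷ M) ⁆ G Z))) ⟩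
    ∑ₛ (λ Y → ⁅ Y ⊆ᵇ (true ∷ M) ⁆ F Y) ⊗ ∑ₛ (λ Z → ⁅ disjointᵇ Z (true ∷ M) ⁆ G Z) ∎
    where
      Fs Gs : Bool → Carrier₀
      Fs b = ∑ₛ (λ Y → ⁅ Y ⊆ᵇ M ⁆ F (b ∷ Y))
      Gs b = ∑ₛ (λ Z → ⁅ disjointᵇ Z M ⁆ G (b ∷ Z))
  ∑ₛ-split {suc n} (false ∷ M) F G = begin
    ∑ₛ (λ X → F (X ∩ (false ∷ M)) ⊗ G (X ∖ (false ∷ M)))
      ≡⟨ trans (∑ₛ-suc (λ X → F (X ∩ (false ∷ M)) ⊗ G (X ∖ (false ∷ M))))
               (∑ₛ-⊕ (λ v → F (false ∷ (v ∩ M)) ⊗ G (true ∷ (v ∖ M))) (λ v → F (false ∷ (v ∩ M)) ⊗ G (false ∷ (v ∖ M)))) ⟩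
    ∑ₛ (λ v → F (false ∷ (v ∩ M)) ⊗ G (true ∷ (v ∖ M))) ⊕ ∑ₛ (λ v → F (false ∷ (v ∩ M)) ⊗ G (false ∷ (v ∖ M)))
      ≡⟨ cong₂ _⊕_ (∑ₛ-split M (F ∘ (false ∷_)) (G ∘ (true ∷_))) (∑ₛ-split M (F ∘ (false ∷_)) (G ∘ (false ∷_))) ⟩
    Fs ⊗ Gs true ⊕ Fs ⊗ Gs false
      ≡⟨ sym (⊗-distribˡ Fs (Gs true) (Gs false)) ⟩
    Fs ⊗ (Gs true ⊕ Gs false)
      ≡⟨ cong₂ _⊗_ (sym (∑ₛ-suc (λ Y → ⁅ Y ⊆ᵇ (false ∷ M) ⁆ F Y)))
                   (trans (sym (∑ₛ-⊕ (λ Z → ⁅ disjointᵇ Z M ⁆ G (true ∷ Z)) (λ Z → ⁅ disjointᵇ Z M ⁆ G (false ∷ Z))))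
                          (sym (∑ₛ-suc (λ Z → ⁅ disjointᵇ Z (false ∷ M) ⁆ G Z)))) ⟩
    ∑ₛ (λ Y → ⁅ Y ⊆ᵇ (false ∷ M) ⁆ F Y) ⊗ ∑ₛ (λ Z → ⁅ disjointᵇ Z (false ∷ M) ⁆ G Z) ∎
    where
      Fs : Carrier₀
      Fs = ∑ₛ (λ Y → ⁅ Y ⊆ᵇ M ⁆ F (false ∷ Y))
      Gs : Bool → Carrier₀
      Gs b = ∑ₛ (λ Z → ⁅ disjointᵇ Z M ⁆ G (b ∷ Z))

module SubsetProduct (S : Semifield) where
  open SemifieldProperties S

  ∏ : ∀ {n} → (Fin n → Carrier) → Vec Bool n → Carrier
  ∏ π [] = 1#
  ∏ π (true ∷ X) = π zero * ∏ (π ∘ suc) X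
  ∏ π (false ∷ X) = ∏ (π ∘ suc) X

  foldr≡∏ : ∀ {n} (π : Fin n → Carrier) (X : Vec Bool n) →
    foldr (λ p acc → if lookup X p then π p * acc else acc) 1# (allFin n) ≡ ∏ π X
  foldr≡∏ π [] = refl
  foldr≡∏ π (true ∷ X) =
    trans (foldr-allFin-suc (λ p acc → if lookup (true ∷ X) p then π p * acc else acc) 1#)
          (cong (π zero *_) (foldr≡∏ (π ∘ suc) X))
  foldr≡∏ π (false ∷ X) =
    trans (foldr-allFin-suc (λ p acc → if lookup (false ∷ X) p then π p * acc else acc) 1#)
          (foldr≡∏ (π ∘ suc) X)

  ∏-insert : ∀ {n} (π : Fin n → Carrier) (X : Vec Bool n) p → lookup X p ≡ false →
    ∏ π (X [ p ]≔ true) ≡ π p * ∏ π X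
  ∏-insert π (false ∷ X) zero e = refl
  ∏-insert π (true ∷ X) (suc p) e = trans (cong (π zero *_) (∏-insert (π ∘ suc) X p e)) (*-lcomm _ _ _)
  ∏-insert π (false ∷ X) (suc p) e = ∏-insert (π ∘ suc) X p e

  ∏-split : ∀ {n} (π : Fin n → Carrier) (X M : Vec Bool n) → ∏ π X ≡ ∏ π (X ∩ M) * ∏ π (X ∖ M)
  ∏-split π [] [] = sym (*-identityˡ 1#)
  ∏-split π (true ∷ X) (true ∷ M) = trans (cong (π zero *_) (∏-split (π ∘ suc) X M)) (sym (*-assoc _ _ _))
  ∏-split π (true ∷ X) (false ∷ M) = trans (cong (π zero *_) (∏-split (π ∘ suc) X M)) (*-lcomm _ _ _)
  ∏-split π (false ∷ X) (true ∷ M) = ∏-split (π ∘ suc) X M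
  ∏-split π (false ∷ X) (false ∷ M) = ∏-split (π ∘ suc) X M

  ∏-empty : ∀ {n} (π : Fin n → Carrier) → ∏ π (replicate n false) ≡ 1#
  ∏-empty {zero} π = refl
  ∏-empty {suc n} π = ∏-empty (π ∘ suc)

record IsGradedRegion (n : ℕ) (le : Fin n → Fin n → Bool) (mem : Fin n → Bool) (rk : Fin n → ℕ) (r : ℕ) : Set where
  field
    le-refl    : ∀ p → T (le p p)
    le-antisym : ∀ p q → T (le p q) → T (le q p) → p ≡ q
    le-trans   : ∀ p q s → T (le p q) → T (le q s) → T (le p s)
    rk-<       : ∀ p q → T (mem p) → T (mem q) → T (le p q) → ¬ p ≡ q → rk p < rk q
    rk-cover   : ∀ p q → T (mem p) → T (mem q) → T (le p q) → ¬ p ≡ q →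
                 (∀ z → T (mem z) → T (le p z) → T (le z q) → z ≡ p ⊎ z ≡ q) → rk q ≡ suc (rk p)
    exists-below : ∀ p → T (mem p) → 0 < rk p → ∃[ q ] (T (mem q) × T (le q p) × ¬ q ≡ p)
    exists-above : ∀ p → T (mem p) → rk p < r → ∃[ q ] (T (mem q) × T (le p q) × ¬ q ≡ p)
    rk-≤       : ∀ p → T (mem p) → rk p ≤ r

module GradedRegion {n : ℕ} {le : Fin n → Fin n → Bool} {mem : Fin n → Bool} {rk : Fin n → ℕ} {r : ℕ}
                    (G : IsGradedRegion n le mem rk r) where
  open IsGradedRegion G public

  comparable : Fin n → Fin n → Bool
  comparable p q = le p q ∨ le q p

  comparable-sym : ∀ {p q} → T (comparable p q) → T (comparable q p)
  comparable-sym {p} {q} t with T-∨-elim {le p q} t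
  ... | inj₁ pq = T-∨ʳ {le q p} pq
  ... | inj₂ qp = T-∨ˡ qp

  comparable-refl : ∀ p → T (comparable p p)
  comparable-refl p = T-∨ˡ (le-refl p)

  rk-≤-mono : ∀ p q → T (mem p) → T (mem q) → T (le p q) → rk p ≤ rk q
  rk-≤-mono p q mp mq pq with p ≟ᶠ q
  ... | yes refl = ℕₚ.≤-refl
  ... | no p≢q = ℕₚ.<⇒≤ (rk-< p q mp mq pq p≢q)

  comparable-same-rk : ∀ p q → T (mem p) → T (mem q) → T (comparable p q) → rk p ≡ rk q → p ≡ q
  comparable-same-rk p q mp mq c e with p ≟ᶠ q
  ... | yes p≡q = p≡q
  ... | no p≢q with T-∨-elim {le p q} c
  ...   | inj₁ pq = ⊥-elim (ℕₚ.<-irrefl e (rk-< p q mp mq pq p≢q))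
  ...   | inj₂ qp = ⊥-elim (ℕₚ.<-irrefl (sym e) (rk-< q p mq mp qp (≢-sym p≢q)))

  comparable-rk-≤⇒le : ∀ p q → T (mem p) → T (mem q) → T (comparable p q) → rk p ≤ rk q → T (le p q)
  comparable-rk-≤⇒le p q mp mq c h with T-∨-elim {le p q} c
  ... | inj₁ pq = pq
  ... | inj₂ qp with p ≟ᶠ q
  ...   | yes refl = qp
  ...   | no p≢q = ⊥-elim (ℕₚ.n≮n _ (ℕₚ.≤-<-trans h (rk-< q p mq mp qp (≢-sym p≢q))))

  isChainᵇ : (Fin n → Bool) → Bool
  isChainᵇ X = allB (λ p → allB (λ q → not (X p ∧ X q) ∨ comparable p q))

  isChainᵇ-elim : ∀ X → T (isChainᵇ X) → ∀ y z → T (X y) → T (X z) → T (comparable y z)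
  isChainᵇ-elim X t y z ty tz
    with T-∨-elim {not (X y ∧ X z)} (allB-elim _ (allB-elim (λ p → allB (λ q → not (X p ∧ X q) ∨ comparable p q)) t y) z)
  ... | inj₁ nyz = ⊥-elim (T-not-elim nyz (T-∧-intro ty tz))
  ... | inj₂ c = c

  isChainᵇ-intro : ∀ X → (∀ y z → T (X y) → T (X z) → T (comparable y z)) → T (isChainᵇ X)
  isChainᵇ-intro X h = allB-intro _ (λ y → allB-intro _ (λ z → pair y z))
    where
      pair : ∀ y z → T (not (X y ∧ X z) ∨ comparable y z)
      pair y z with T-dec (X y ∧ X z)
      ... | inj₁ t = T-∨ʳ {not (X y ∧ X z)} (h y z (T-∧ˡ t) (T-∧ʳ {X y} t))
      ... | inj₂ f = T-∨ˡ (T-not-intro f)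

  -- Toggles.isMaxChain with R for the membership predicate; chainSum≡D*U relies on the two
  -- agreeing definitionally.
  maxChainᵇ : (Fin n → Bool) → Vec Bool n → Bool
  maxChainᵇ R X = allB (λ p → not (lookup X p) ∨ R p) ∧
                  isChainᵇ (lookup X) ∧
                  allB (λ y → not (R y) ∨ lookup X y ∨ not (isChainᵇ (λ p → lookup X p ∨ eqF p y)))

  record MaxChain (R : Fin n → Bool) (X : Vec Bool n) : Set where
    field
      ⊆-region : ∀ y → T (lookup X y) → T (R y)
      chain    : ∀ y z → T (lookup X y) → T (lookup X z) → T (comparable y z)
      maximal  : ∀ y → T (R y) → (∀ z → T (lookup X z) → T (comparable y z)) → T (lookup X y)
  open MaxChain public

  private
    extend-chain : ∀ (X : Vec Bool n) y → (∀ y z → T (lookup X y) → T (lookup X z) → T (comparable y z)) →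
      (∀ z → T (lookup X z) → T (comparable y z)) → T (isChainᵇ (λ p → lookup X p ∨ eqF p y))
    extend-chain X y ch cy = isChainᵇ-intro _ pair
      where
        pair : ∀ a b → T (lookup X a ∨ eqF a y) → T (lookup X b ∨ eqF b y) → T (comparable a b)
        pair a b ta tb with T-∨-elim {lookup X a} ta | T-∨-elim {lookup X b} tb
        ... | inj₁ xa | inj₁ xb = ch a b xa xb
        ... | inj₁ xa | inj₂ eb rewrite eqF-sound {p = b} eb = comparable-sym (cy a xa)
        ... | inj₂ ea | inj₁ xb rewrite eqF-sound {p = a} ea = cy b xb
        ... | inj₂ ea | inj₂ eb rewrite eqF-sound {p = a} ea | eqF-sound {p = b} eb = comparable-refl y

  maxChainᵇ-sound : ∀ R X → T (maxChainᵇ R X) → MaxChain R X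
  maxChainᵇ-sound R X t = record { ⊆-region = sub ; chain = isChainᵇ-elim (lookup X) chainᵇ ; maximal = max }
    where
      subᵇ = T-∧ˡ {allB (λ p → not (lookup X p) ∨ R p)} t
      chainᵇ = T-∧ˡ {isChainᵇ (lookup X)} (T-∧ʳ {allB (λ p → not (lookup X p) ∨ R p)} t)
      maxᵇ = T-∧ʳ {isChainᵇ (lookup X)} (T-∧ʳ {allB (λ p → not (lookup X p) ∨ R p)} t)
      sub : ∀ y → T (lookup X y) → T (R y)
      sub y ty with T-∨-elim {not (lookup X y)} (allB-elim _ subᵇ y)
      ... | inj₁ nty = ⊥-elim (T-not-elim nty ty)
      ... | inj₂ ry = ry
      max : ∀ y → T (R y) → (∀ z → T (lookup X z) → T (comparable y z)) → T (lookup X y)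
      max y ry cy with T-∨-elim {not (R y)} (allB-elim _ maxᵇ y)
      ... | inj₁ nry = ⊥-elim (T-not-elim nry ry)
      ... | inj₂ b with T-∨-elim {lookup X y} b
      ...   | inj₁ xy = xy
      ...   | inj₂ nch = ⊥-elim (T-not-elim nch (extend-chain X y (isChainᵇ-elim (lookup X) chainᵇ) cy))

  maxChainᵇ-complete : ∀ R X → MaxChain R X → T (maxChainᵇ R X)
  maxChainᵇ-complete R X m =
    T-∧-intro (allB-intro _ sub) (T-∧-intro (isChainᵇ-intro (lookup X) (chain m)) (allB-intro _ max))
    where
      sub : ∀ p → T (not (lookup X p) ∨ R p)
      sub p with T-dec (lookup X p)
      ... | inj₁ t = T-∨ʳ {not (lookup X p)} (⊆-region m p t)
      ... | inj₂ f = T-∨ˡ (T-not-intro f)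
      max : ∀ y → T (not (R y) ∨ lookup X y ∨ not (isChainᵇ (λ p → lookup X p ∨ eqF p y)))
      max y with T-dec (R y) | T-dec (lookup X y)
      ... | inj₂ nry | _ = T-∨ˡ (T-not-intro nry)
      ... | inj₁ ry | inj₁ xy = T-∨ʳ {not (R y)} (T-∨ˡ xy)
      ... | inj₁ ry | inj₂ nxy = T-∨ʳ {not (R y)} (T-∨ʳ {lookup X y} (T-not-intro λ c →
            nxy (maximal m y ry (λ z tz → isChainᵇ-elim _ c y z (T-∨ʳ {lookup X y} (eqF-refl y)) (T-∨ˡ tz)))))

  _<ᵇ_ : Fin n → Fin n → Bool
  p <ᵇ y = le p y ∧ not (eqF p y)

  <ᵇ-intro : ∀ {p y} → T (le p y) → ¬ p ≡ y → T (p <ᵇ y)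
  <ᵇ-intro pq p≢y = T-∧-intro pq (T-not-intro (λ t → p≢y (eqF-sound t)))

  <ᵇ-le : ∀ {p y} → T (p <ᵇ y) → T (le p y)
  <ᵇ-le = T-∧ˡ

  <ᵇ-≢ : ∀ {p y} → T (p <ᵇ y) → ¬ p ≡ y
  <ᵇ-≢ {p} {y} t refl = T-not-elim (T-∧ʳ {le p y} t) (eqF-refl p)

  rk-<ᵇ : ∀ {p q} → T (mem p) → T (mem q) → T (p <ᵇ q) → rk p < rk q
  rk-<ᵇ {p} {q} mp mq pq = rk-< p q mp mq (<ᵇ-le pq) (<ᵇ-≢ pq)

  downᵇ upᵇ : Fin n → Fin n → Bool
  downᵇ p y = mem y ∧ le y p
  upᵇ p y = mem y ∧ p <ᵇ y

  downᵇ-mem : ∀ {p y} → T (downᵇ p y) → T (mem y)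
  downᵇ-mem = T-∧ˡ

  downᵇ-le : ∀ {p y} → T (downᵇ p y) → T (le y p)
  downᵇ-le {p} {y} = T-∧ʳ {mem y}

  upᵇ-mem : ∀ {p y} → T (upᵇ p y) → T (mem y)
  upᵇ-mem = T-∧ˡ

  upᵇ-< : ∀ {p y} → T (upᵇ p y) → T (p <ᵇ y)
  upᵇ-< {p} {y} = T-∧ʳ {mem y}

  downVec : Fin n → Vec Bool n
  downVec p = tabulateᵛ (λ y → le y p)

  downChainᵇ : Fin n → Vec Bool n → Bool
  downChainᵇ p Y = maxChainᵇ (downᵇ p) Y ∧ lookup Y p

  upChainᵇ : Fin n → Vec Bool n → Bool
  upChainᵇ p Z = maxChainᵇ (upᵇ p) Z

  downChainᵇ-sound : ∀ p Y → T (downChainᵇ p Y) → MaxChain (downᵇ p) Y × T (lookup Y p)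
  downChainᵇ-sound p Y t = maxChainᵇ-sound (downᵇ p) Y (T-∧ˡ t) , T-∧ʳ {maxChainᵇ (downᵇ p) Y} t

  downChainᵇ-complete : ∀ p Y → MaxChain (downᵇ p) Y → T (lookup Y p) → T (downChainᵇ p Y)
  downChainᵇ-complete p Y d yp = T-∧-intro (maxChainᵇ-complete (downᵇ p) Y d) yp

  lookup-∩-downVec : ∀ X p y → lookup (X ∩ downVec p) y ≡ (lookup X y ∧ le y p)
  lookup-∩-downVec X p y = trans (lookup-zipWith _∧_ y X (downVec p)) (cong (lookup X y ∧_) (lookup∘tabulate _ y))

  lookup-∖-downVec : ∀ X p y → lookup (X ∖ downVec p) y ≡ (lookup X y ∧ not (le y p))
  lookup-∖-downVec X p y =
    trans (lookup-zipWith (λ x m → x ∧ not m) y X (downVec p)) (cong (λ b → lookup X y ∧ not b) (lookup∘tabulate _ y))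

  ∈-∩-downVec⁻ : ∀ X p y → T (lookup (X ∩ downVec p) y) → T (lookup X y) × T (le y p)
  ∈-∩-downVec⁻ X p y t = let t′ = subst T (lookup-∩-downVec X p y) t in T-∧ˡ t′ , T-∧ʳ {lookup X y} t′

  ∈-∩-downVec⁺ : ∀ X p y → T (lookup X y) → T (le y p) → T (lookup (X ∩ downVec p) y)
  ∈-∩-downVec⁺ X p y xy yp = subst T (sym (lookup-∩-downVec X p y)) (T-∧-intro xy yp)

  ∈-∖-downVec⁻ : ∀ X p y → T (lookup (X ∖ downVec p) y) → T (lookup X y) × ¬ T (le y p)
  ∈-∖-downVec⁻ X p y t = let t′ = subst T (lookup-∖-downVec X p y) t in T-∧ˡ t′ , T-not-elim (T-∧ʳ {lookup X y} t′)

  ∈-∖-downVec⁺ : ∀ X p y → T (lookup X y) → ¬ T (le y p) → T (lookup (X ∖ downVec p) y)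
  ∈-∖-downVec⁺ X p y xy nyp = subst T (sym (lookup-∖-downVec X p y)) (T-∧-intro xy (T-not-intro nyp))

  module _ (p : Fin n) (X : Vec Bool n) where
    private
      ∩↓ = X ∩ downVec p
      ∖↓ = X ∖ downVec p

    maxChain-split : MaxChain mem X → T (lookup X p) →
                     (MaxChain (downᵇ p) ∩↓ × T (lookup ∩↓ p)) × MaxChain (upᵇ p) ∖↓
    maxChain-split m xp =
      (record { ⊆-region = dsub ; chain = dch ; maximal = dmax } , ∈-∩-downVec⁺ X p p xp (le-refl p)) ,
      record { ⊆-region = usub ; chain = uch ; maximal = umax }
      where
        dsub : ∀ y → T (lookup ∩↓ y) → T (downᵇ p y)
        dsub y t = let (xy , yp) = ∈-∩-downVec⁻ X p y t in T-∧-intro (⊆-region m y xy) yp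
        dch : ∀ y z → T (lookup ∩↓ y) → T (lookup ∩↓ z) → T (comparable y z)
        dch y z ty tz = chain m y z (proj₁ (∈-∩-downVec⁻ X p y ty)) (proj₁ (∈-∩-downVec⁻ X p z tz))
        dmax : ∀ y → T (downᵇ p y) → (∀ z → T (lookup ∩↓ z) → T (comparable y z)) → T (lookup ∩↓ y)
        dmax y ry cy = ∈-∩-downVec⁺ X p y (maximal m y (downᵇ-mem ry) cz) (downᵇ-le ry)
          where
            cz : ∀ z → T (lookup X z) → T (comparable y z)
            cz z xz with T-dec (le z p)
            ... | inj₁ zp = cy z (∈-∩-downVec⁺ X p z xz zp)
            ... | inj₂ nzp with T-∨-elim {le z p} (chain m z p xz xp)
            ...   | inj₁ zp = ⊥-elim (nzp zp)
            ...   | inj₂ pz = T-∨ˡ (le-trans y p z (downᵇ-le ry) pz)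
        usub : ∀ y → T (lookup ∖↓ y) → T (upᵇ p y)
        usub y t with ∈-∖-downVec⁻ X p y t
        ... | (xy , nyp) with T-∨-elim {le y p} (chain m y p xy xp)
        ...   | inj₁ yp = ⊥-elim (nyp yp)
        ...   | inj₂ py = T-∧-intro (⊆-region m y xy) (<ᵇ-intro py (λ { refl → nyp (le-refl p) }))
        uch : ∀ y z → T (lookup ∖↓ y) → T (lookup ∖↓ z) → T (comparable y z)
        uch y z ty tz = chain m y z (proj₁ (∈-∖-downVec⁻ X p y ty)) (proj₁ (∈-∖-downVec⁻ X p z tz))
        umax : ∀ y → T (upᵇ p y) → (∀ z → T (lookup ∖↓ z) → T (comparable y z)) → T (lookup ∖↓ y)
        umax y ry cy = ∈-∖-downVec⁺ X p y (maximal m y (upᵇ-mem ry) cz) (λ yp → <ᵇ-≢ (upᵇ-< ry) (le-antisym p y py yp))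
          where
            py = <ᵇ-le (upᵇ-< ry)
            cz : ∀ z → T (lookup X z) → T (comparable y z)
            cz z xz with T-dec (le z p)
            ... | inj₁ zp = T-∨ʳ {le y z} (le-trans z p y zp py)
            ... | inj₂ nzp = cy z (∈-∖-downVec⁺ X p z xz nzp)

    maxChain-join : (MaxChain (downᵇ p) ∩↓ × T (lookup ∩↓ p)) × MaxChain (upᵇ p) ∖↓ → MaxChain mem X × T (lookup X p)
    maxChain-join ((d , dp) , u) = record { ⊆-region = sub ; chain = ch ; maximal = max } , xp
      where
        xp = proj₁ (∈-∩-downVec⁻ X p p dp)
        below : ∀ {y} → T (lookup X y) → T (le y p) → T (lookup ∩↓ y)
        below = ∈-∩-downVec⁺ X p _
        above : ∀ {y} → T (lookup X y) → ¬ T (le y p) → T (lookup ∖↓ y)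
        above = ∈-∖-downVec⁺ X p _
        sub : ∀ y → T (lookup X y) → T (mem y)
        sub y xy with T-dec (le y p)
        ... | inj₁ yp = downᵇ-mem (⊆-region d y (below xy yp))
        ... | inj₂ nyp = upᵇ-mem (⊆-region u y (above xy nyp))
        ch : ∀ y z → T (lookup X y) → T (lookup X z) → T (comparable y z)
        ch y z xy xz with T-dec (le y p) | T-dec (le z p)
        ... | inj₁ yp | inj₁ zp = chain d y z (below xy yp) (below xz zp)
        ... | inj₂ nyp | inj₂ nzp = chain u y z (above xy nyp) (above xz nzp)
        ... | inj₁ yp | inj₂ nzp = T-∨ˡ (le-trans y p z yp (<ᵇ-le (upᵇ-< (⊆-region u z (above xz nzp)))))
        ... | inj₂ nyp | inj₁ zp = T-∨ʳ {le y z} (le-trans z p y zp (<ᵇ-le (upᵇ-< (⊆-region u y (above xy nyp)))))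
        max : ∀ y → T (mem y) → (∀ z → T (lookup X z) → T (comparable y z)) → T (lookup X y)
        max y my cy with y ≟ᶠ p
        ... | yes refl = xp
        ... | no y≢p with T-∨-elim {le y p} (cy p xp)
        ...   | inj₁ yp = proj₁ (∈-∩-downVec⁻ X p y (maximal d y (T-∧-intro my yp) (λ z tz → cy z (proj₁ (∈-∩-downVec⁻ X p z tz)))))
        ...   | inj₂ py = proj₁ (∈-∖-downVec⁻ X p y (maximal u y (T-∧-intro my (<ᵇ-intro py (≢-sym y≢p)))
                                                                (λ z tz → cy z (proj₁ (∈-∖-downVec⁻ X p z tz)))))

    maxChainThroughᵇ-split : (maxChainᵇ mem X ∧ lookup X p) ≡ (downChainᵇ p ∩↓ ∧ upChainᵇ p ∖↓)
    maxChainThroughᵇ-split = T-ext to from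
      where
        to : T (maxChainᵇ mem X ∧ lookup X p) → T (downChainᵇ p ∩↓ ∧ upChainᵇ p ∖↓)
        to t = let ((d , dp) , u) = maxChain-split (maxChainᵇ-sound mem X (T-∧ˡ t)) (T-∧ʳ {maxChainᵇ mem X} t) in
               T-∧-intro (downChainᵇ-complete p ∩↓ d dp) (maxChainᵇ-complete (upᵇ p) ∖↓ u)
        from : T (downChainᵇ p ∩↓ ∧ upChainᵇ p ∖↓) → T (maxChainᵇ mem X ∧ lookup X p)
        from t = let (m , xp) = maxChain-join (downChainᵇ-sound p ∩↓ (T-∧ˡ {downChainᵇ p ∩↓} t) ,
                                               maxChainᵇ-sound (upᵇ p) ∖↓ (T-∧ʳ {downChainᵇ p ∩↓} t)) in
                 T-∧-intro (maxChainᵇ-complete mem X m) xp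

  downChain-⊆ : ∀ p Y → T (downChainᵇ p Y) → T (Y ⊆ᵇ downVec p)
  downChain-⊆ p Y t = ⊆ᵇ-intro Y (downVec p) (λ y ty →
    subst T (sym (lookup∘tabulate _ y)) (downᵇ-le (⊆-region (proj₁ (downChainᵇ-sound p Y t)) y ty)))

  upChain-disjoint : ∀ p Z → T (upChainᵇ p Z) → T (disjointᵇ Z (downVec p))
  upChain-disjoint p Z t = disjointᵇ-intro Z (downVec p) (λ y ty yp →
    let py = upᵇ-< (⊆-region (maxChainᵇ-sound (upᵇ p) Z t) y ty) in
    <ᵇ-≢ py (le-antisym p y (<ᵇ-le py) (subst T (lookup∘tabulate _ y) yp)))

  nothing-between⇒rk-cover : ∀ {a b} → T (mem a) → T (mem b) → T (le a b) → ¬ a ≡ b →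
    (∀ z → T (mem z) → T (le a z) → T (le z b) → ¬ z ≡ a → ¬ z ≡ b → ⊥) → rk b ≡ suc (rk a)
  nothing-between⇒rk-cover {a} {b} ma mb ab a≢b none = rk-cover a b ma mb ab a≢b between
    where
      between : ∀ z → T (mem z) → T (le a z) → T (le z b) → z ≡ a ⊎ z ≡ b
      between z mz az zb with z ≟ᶠ a | z ≟ᶠ b
      ... | yes z≡a | _ = inj₁ z≡a
      ... | no _ | yes z≡b = inj₂ z≡b
      ... | no z≢a | no z≢b = ⊥-elim (none z mz az zb z≢a z≢b)

  lowerCoverᵇ upperCoverᵇ : Fin n → Fin n → Bool
  lowerCoverᵇ p q = mem q ∧ le q p ∧ (suc (rk q) ≡ᵇ rk p)
  upperCoverᵇ p q = mem q ∧ le p q ∧ (suc (rk p) ≡ᵇ rk q)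

  lowerCovers upperCovers : Fin n → List (Fin n)
  lowerCovers p = filterᵇ (lowerCoverᵇ p) (allFin n)
  upperCovers p = filterᵇ (upperCoverᵇ p) (allFin n)

  module _ {p q : Fin n} where
    lowerCover-intro : T (mem q) → T (le q p) → suc (rk q) ≡ rk p → T (lowerCoverᵇ p q)
    lowerCover-intro mq qp e = T-∧-intro mq (T-∧-intro qp (ℕₚ.≡⇒≡ᵇ (suc (rk q)) (rk p) e))

    lowerCover-mem : T (lowerCoverᵇ p q) → T (mem q)
    lowerCover-mem = T-∧ˡ

    lowerCover-le : T (lowerCoverᵇ p q) → T (le q p)
    lowerCover-le t = T-∧ˡ (T-∧ʳ {mem q} t)

    lowerCover-rk : T (lowerCoverᵇ p q) → suc (rk q) ≡ rk p
    lowerCover-rk t = ℕₚ.≡ᵇ⇒≡ (suc (rk q)) (rk p) (T-∧ʳ {le q p} (T-∧ʳ {mem q} t))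

    upperCover-intro : T (mem q) → T (le p q) → suc (rk p) ≡ rk q → T (upperCoverᵇ p q)
    upperCover-intro mq pq e = T-∧-intro mq (T-∧-intro pq (ℕₚ.≡⇒≡ᵇ (suc (rk p)) (rk q) e))

    upperCover-mem : T (upperCoverᵇ p q) → T (mem q)
    upperCover-mem = T-∧ˡ

    upperCover-le : T (upperCoverᵇ p q) → T (le p q)
    upperCover-le t = T-∧ˡ (T-∧ʳ {mem q} t)

    upperCover-rk : T (upperCoverᵇ p q) → suc (rk p) ≡ rk q
    upperCover-rk t = ℕₚ.≡ᵇ⇒≡ (suc (rk p)) (rk q) (T-∧ʳ {le p q} (T-∧ʳ {mem q} t))

    lowerCover-< : T (lowerCoverᵇ p q) → T (q <ᵇ p)
    lowerCover-< t = <ᵇ-intro (lowerCover-le t) (λ { refl → ℕₚ.1+n≰n (ℕₚ.≤-reflexive (lowerCover-rk t)) })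

    upperCover-< : T (upperCoverᵇ p q) → T (p <ᵇ q)
    upperCover-< t = <ᵇ-intro (upperCover-le t) (λ { refl → ℕₚ.1+n≰n (ℕₚ.≤-reflexive (upperCover-rk t)) })

    ∈-lowerCovers⁻ : q ∈ lowerCovers p → T (lowerCoverᵇ p q)
    ∈-lowerCovers⁻ m = proj₂ (∈-filter⁻ (T? ∘ lowerCoverᵇ p) {xs = allFin n} m)

    ∈-upperCovers⁻ : q ∈ upperCovers p → T (upperCoverᵇ p q)
    ∈-upperCovers⁻ m = proj₂ (∈-filter⁻ (T? ∘ upperCoverᵇ p) {xs = allFin n} m)

  lowerCovers-nonempty : ∀ p → T (mem p) → 0 < rk p → ∃[ q ] q ∈ lowerCovers p
  lowerCovers-nonempty p mp pos with exists-below p mp pos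
  ... | y₀ , my₀ , y₀≤p , y₀≢p with argmaxᵇ (λ y → mem y ∧ y <ᵇ p) rk y₀ (T-∧-intro my₀ (<ᵇ-intro y₀≤p y₀≢p))
  ...   | q , q<p , maximum = q , ∈-filter⁺ (T? ∘ lowerCoverᵇ p) (∈-allFin q) (lowerCover-intro mq q≤p (sym rk-p))
    where
      mq = T-∧ˡ q<p
      q≤p = <ᵇ-le (T-∧ʳ {mem q} q<p)
      none : ∀ z → T (mem z) → T (le q z) → T (le z p) → ¬ z ≡ q → ¬ z ≡ p → ⊥
      none z mz qz zp z≢q z≢p = ℕₚ.<⇒≱ (rk-< q z mq mz qz (≢-sym z≢q)) (maximum z (T-∧-intro mz (<ᵇ-intro zp z≢p)))
      rk-p = nothing-between⇒rk-cover mq mp q≤p (<ᵇ-≢ (T-∧ʳ {mem q} q<p)) none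

  upperCovers-nonempty : ∀ p → T (mem p) → rk p < r → ∃[ q ] q ∈ upperCovers p
  upperCovers-nonempty p mp p<r with exists-above p mp p<r
  ... | y₀ , my₀ , p≤y₀ , y₀≢p with argminᵇ (λ y → mem y ∧ p <ᵇ y) rk y₀ (T-∧-intro my₀ (<ᵇ-intro p≤y₀ (≢-sym y₀≢p)))
  ...   | q , p<q , minimum = q , ∈-filter⁺ (T? ∘ upperCoverᵇ p) (∈-allFin q) (upperCover-intro mq p≤q (sym rk-q))
    where
      mq = T-∧ˡ p<q
      p≤q = <ᵇ-le (T-∧ʳ {mem q} p<q)
      none : ∀ z → T (mem z) → T (le p z) → T (le z q) → ¬ z ≡ p → ¬ z ≡ q → ⊥
      none z mz pz zq z≢p z≢q = ℕₚ.<⇒≱ (rk-< z q mz mq zq z≢q) (minimum z (T-∧-intro mz (<ᵇ-intro pz (≢-sym z≢p))))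
      rk-q = nothing-between⇒rk-cover mp mq p≤q (<ᵇ-≢ (T-∧ʳ {mem q} p<q)) none

  downChain-minimal : ∀ p → T (mem p) → rk p ≡ 0 → ∀ X →
    (not (lookup X p) ∧ downChainᵇ p (X [ p ]≔ true)) ≡ emptyᵇ X
  downChain-minimal p mp rp X = T-ext to from
    where
      only-p : ∀ y → T (downᵇ p y) → y ≡ p
      only-p y ry with y ≟ᶠ p
      ... | yes y≡p = y≡p
      ... | no y≢p = ⊥-elim (ℕₚ.n≮0 (subst (rk y <_) rp (rk-< y p (downᵇ-mem ry) mp (downᵇ-le ry) y≢p)))
      to : T (not (lookup X p) ∧ downChainᵇ p (X [ p ]≔ true)) → T (emptyᵇ X)
      to t = emptyᵇ-intro X λ y xy →
        let p∉X = T-not-elim (T-∧ˡ {not (lookup X p)} t)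
            d = proj₁ (downChainᵇ-sound p (X [ p ]≔ true) (T-∧ʳ {not (lookup X p)} t))
            y≢p = ∉⇒≢ X p∉X xy in
        y≢p (only-p y (⊆-region d y (update-∈⁺ X true y≢p xy)))
      from : T (emptyᵇ X) → T (not (lookup X p) ∧ downChainᵇ p (X [ p ]≔ true))
      from e = T-∧-intro (T-not-intro (emptyᵇ-elim X e p)) (downChainᵇ-complete p (X [ p ]≔ true) d (insert-∈ X p))
        where
          in-Y⇒≡p : ∀ y → T (lookup (X [ p ]≔ true) y) → y ≡ p
          in-Y⇒≡p y t with insert-∈⁻ X p y t
          ... | inj₁ y≡p = y≡p
          ... | inj₂ (_ , xy) = ⊥-elim (emptyᵇ-elim X e y xy)
          d : MaxChain (downᵇ p) (X [ p ]≔ true)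
          d = record
            { ⊆-region = λ y t → subst (T ∘ downᵇ p) (sym (in-Y⇒≡p y t)) (T-∧-intro mp (le-refl p))
            ; chain = λ y z ty tz → subst₂ (λ a b → T (comparable a b)) (sym (in-Y⇒≡p y ty)) (sym (in-Y⇒≡p z tz)) (comparable-refl p)
            ; maximal = λ y ry _ → subst (T ∘ lookup (X [ p ]≔ true)) (sym (only-p y ry)) (insert-∈ X p) }

  module DownStep (p : Fin n) (mp : T (mem p)) (s : ℕ) (rp : rk p ≡ suc s) where

    module _ (X : Vec Bool n) (p∉X : ¬ T (lookup X p)) (d : MaxChain (downᵇ p) (X [ p ]≔ true)) where
      private
        Y = X [ p ]≔ true

        ∈Y : ∀ {y} → T (lookup X y) → T (lookup Y y)
        ∈Y xy = update-∈⁺ X true (∉⇒≢ X p∉X xy) xy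

        ∈X : ∀ {y} → ¬ y ≡ p → T (lookup Y y) → T (lookup X y)
        ∈X y≢p = update-∈⁻ X true y≢p

        memX : ∀ {y} → T (lookup X y) → T (mem y)
        memX xy = downᵇ-mem (⊆-region d _ (∈Y xy))

      below-nonempty : ∃[ w ] T (lookup X w)
      below-nonempty with search (lookup X) | exists-below p mp (subst (0 <_) (sym rp) (s≤s z≤n))
      ... | inj₁ w | _ = w
      ... | inj₂ X-empty | y₀ , my₀ , y₀≤p , y₀≢p =
        ⊥-elim (X-empty y₀ (∈X y₀≢p (maximal d y₀ (T-∧-intro my₀ y₀≤p) comparable-all)))
        where
          comparable-all : ∀ z → T (lookup Y z) → T (comparable y₀ z)
          comparable-all z tz with insert-∈⁻ X p z tz
          ... | inj₁ refl = T-∨ˡ y₀≤p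
          ... | inj₂ (_ , xz) = ⊥-elim (X-empty z xz)

      private
        top = argmaxᵇ (lookup X) rk (proj₁ below-nonempty) (proj₂ below-nonempty)
        q = proj₁ top
        xq = proj₁ (proj₂ top)
        maximum = proj₂ (proj₂ top)
        mq = memX xq
        q≤p = downᵇ-le (⊆-region d q (∈Y xq))

        ≤q : ∀ y → T (lookup X y) → T (le y q)
        ≤q y xy = comparable-rk-≤⇒le y q (memX xy) mq (chain d y q (∈Y xy) (∈Y xq)) (maximum y xy)

        nothing-between : ∀ z → T (mem z) → T (le q z) → T (le z p) → ¬ z ≡ q → ¬ z ≡ p → ⊥
        nothing-between z mz qz zp z≢q z≢p = ℕₚ.<⇒≱ (rk-< q z mq mz qz (≢-sym z≢q)) (maximum z xz)
          where
            comparable-all : ∀ y → T (lookup Y y) → T (comparable z y)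
            comparable-all y ty with insert-∈⁻ X p y ty
            ... | inj₁ refl = T-∨ˡ zp
            ... | inj₂ (_ , xy) = T-∨ʳ {le z y} (le-trans y q z (≤q y xy) qz)
            xz = ∈X z≢p (maximal d z (T-∧-intro mz zp) comparable-all)

      top-lowerCover : T (lowerCoverᵇ p q)
      top-lowerCover = lowerCover-intro mq q≤p (sym (nothing-between⇒rk-cover mq mp q≤p (∉⇒≢ X p∉X xq) nothing-between))

      top-downChain : T (downChainᵇ q X)
      top-downChain = downChainᵇ-complete q X (record { ⊆-region = sub ; chain = ch ; maximal = max }) xq
        where
          sub : ∀ y → T (lookup X y) → T (downᵇ q y)
          sub y xy = T-∧-intro (memX xy) (≤q y xy)
          ch : ∀ y z → T (lookup X y) → T (lookup X z) → T (comparable y z)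
          ch y z xy xz = chain d y z (∈Y xy) (∈Y xz)
          max : ∀ y → T (downᵇ q y) → (∀ z → T (lookup X z) → T (comparable y z)) → T (lookup X y)
          max y ry cy = ∈X y≢p (maximal d y (T-∧-intro (downᵇ-mem ry) (le-trans y q p yq q≤p)) comparable-all)
            where
              yq = downᵇ-le ry
              y≢p : ¬ y ≡ p
              y≢p refl = p∉X (subst (T ∘ lookup X) (le-antisym q p q≤p yq) xq)
              comparable-all : ∀ z → T (lookup Y z) → T (comparable y z)
              comparable-all z tz with insert-∈⁻ X p z tz
              ... | inj₁ refl = T-∨ˡ (le-trans y q z yq q≤p)
              ... | inj₂ (_ , xz) = cy z xz

    step⁻ : ∀ X → T (not (lookup X p) ∧ downChainᵇ p (X [ p ]≔ true)) → ∃[ q ] T (lowerCoverᵇ p q ∧ downChainᵇ q X)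
    step⁻ X t = _ , T-∧-intro (top-lowerCover X p∉X d) (top-downChain X p∉X d)
      where
        p∉X = T-not-elim (T-∧ˡ {not (lookup X p)} t)
        d = proj₁ (downChainᵇ-sound p (X [ p ]≔ true) (T-∧ʳ {not (lookup X p)} t))

    step⁺ : ∀ X q → T (lowerCoverᵇ p q ∧ downChainᵇ q X) → T (not (lookup X p) ∧ downChainᵇ p (X [ p ]≔ true))
    step⁺ X q t = T-∧-intro (T-not-intro p∉X) (downChainᵇ-complete p Y (record { ⊆-region = sub ; chain = ch ; maximal = max }) (insert-∈ X p))
      where
        Y = X [ p ]≔ true
        cov = T-∧ˡ {lowerCoverᵇ p q} t
        dq = downChainᵇ-sound q X (T-∧ʳ {lowerCoverᵇ p q} t)
        xq = proj₂ dq
        mq = lowerCover-mem cov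
        q≤p = lowerCover-le cov
        ≤q : ∀ y → T (lookup X y) → T (le y q)
        ≤q y xy = downᵇ-le (⊆-region (proj₁ dq) y xy)
        ≤p : ∀ y → T (lookup X y) → T (le y p)
        ≤p y xy = le-trans y q p (≤q y xy) q≤p
        p∉X : ¬ T (lookup X p)
        p∉X xp = <ᵇ-≢ (lowerCover-< cov) (le-antisym q p q≤p (≤q p xp))
        ∈Y : ∀ {y} → T (lookup X y) → T (lookup Y y)
        ∈Y xy = update-∈⁺ X true (∉⇒≢ X p∉X xy) xy
        sub : ∀ y → T (lookup Y y) → T (downᵇ p y)
        sub y ty with insert-∈⁻ X p y ty
        ... | inj₁ refl = T-∧-intro mp (le-refl p)
        ... | inj₂ (_ , xy) = T-∧-intro (downᵇ-mem (⊆-region (proj₁ dq) y xy)) (≤p y xy)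
        ch : ∀ y z → T (lookup Y y) → T (lookup Y z) → T (comparable y z)
        ch y z ty tz with insert-∈⁻ X p y ty | insert-∈⁻ X p z tz
        ... | inj₁ refl | inj₁ refl = comparable-refl p
        ... | inj₁ refl | inj₂ (_ , xz) = T-∨ʳ {le p z} (≤p z xz)
        ... | inj₂ (_ , xy) | inj₁ refl = T-∨ˡ (≤p y xy)
        ... | inj₂ (_ , xy) | inj₂ (_ , xz) = chain (proj₁ dq) y z xy xz
        max : ∀ y → T (downᵇ p y) → (∀ z → T (lookup Y z) → T (comparable y z)) → T (lookup Y y)
        max y ry cy with y ≟ᶠ p | y ≟ᶠ q
        ... | yes refl | _ = insert-∈ X p
        ... | no y≢p | yes refl = ∈Y xq
        ... | no y≢p | no y≢q with T-∨-elim {le y q} (cy q (∈Y xq))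
        ...   | inj₁ yq = ∈Y (maximal (proj₁ dq) y (T-∧-intro (downᵇ-mem ry) yq) (λ z xz → cy z (∈Y xz)))
        ...   | inj₂ qy = ⊥-elim (ℕₚ.<⇒≱ (rk-< q y mq (downᵇ-mem ry) qy (≢-sym y≢q))
                                   (ℕₚ.≤-pred (subst (rk y <_) (sym (lowerCover-rk cov)) (rk-< y p (downᵇ-mem ry) mp (downᵇ-le ry) y≢p))))

    step-unique : ∀ X q q′ → T (lowerCoverᵇ p q ∧ downChainᵇ q X) → T (lowerCoverᵇ p q′ ∧ downChainᵇ q′ X) → q ≡ q′
    step-unique X q q′ t t′ =
      comparable-same-rk q q′ (lowerCover-mem cov) (lowerCover-mem cov′) (chain (proj₁ dq) q q′ (proj₂ dq) (proj₂ dq′))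
                         (ℕₚ.suc-injective (trans (lowerCover-rk cov) (sym (lowerCover-rk cov′))))
      where
        cov = T-∧ˡ {lowerCoverᵇ p q} t
        cov′ = T-∧ˡ {lowerCoverᵇ p q′} t′
        dq = downChainᵇ-sound q X (T-∧ʳ {lowerCoverᵇ p q} t)
        dq′ = downChainᵇ-sound q′ X (T-∧ʳ {lowerCoverᵇ p q′} t′)

  upChain-maximal : ∀ p → T (mem p) → rk p ≡ r → ∀ Z → upChainᵇ p Z ≡ emptyᵇ Z
  upChain-maximal p mp rp Z = T-ext to from
    where
      nothing-above : ∀ y → ¬ T (upᵇ p y)
      nothing-above y ry = ℕₚ.<⇒≱ (subst (_< rk y) rp (rk-<ᵇ mp (upᵇ-mem ry) (upᵇ-< ry))) (rk-≤ y (upᵇ-mem ry))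
      to : T (upChainᵇ p Z) → T (emptyᵇ Z)
      to t = emptyᵇ-intro Z (λ y zy → nothing-above y (⊆-region (maxChainᵇ-sound (upᵇ p) Z t) y zy))
      from : T (emptyᵇ Z) → T (upChainᵇ p Z)
      from e = maxChainᵇ-complete (upᵇ p) Z (record
        { ⊆-region = λ y zy → ⊥-elim (emptyᵇ-elim Z e y zy)
        ; chain = λ y z zy _ → ⊥-elim (emptyᵇ-elim Z e y zy)
        ; maximal = λ y ry _ → ⊥-elim (nothing-above y ry) })

  module UpStep (p : Fin n) (mp : T (mem p)) (pr : rk p < r) where

    startsWithᵇ : Vec Bool n → Fin n → Bool
    startsWithᵇ Z q = upperCoverᵇ p q ∧ (lookup Z q ∧ upChainᵇ q (Z [ q ]≔ false))

    module _ (Z : Vec Bool n) (u : MaxChain (upᵇ p) Z) where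
      private
        memZ : ∀ {y} → T (lookup Z y) → T (mem y)
        memZ zy = upᵇ-mem (⊆-region u _ zy)

        p<Z : ∀ {y} → T (lookup Z y) → T (p <ᵇ y)
        p<Z zy = upᵇ-< (⊆-region u _ zy)

      above-nonempty : ∃[ w ] T (lookup Z w)
      above-nonempty with search (lookup Z) | exists-above p mp pr
      ... | inj₁ w | _ = w
      ... | inj₂ Z-empty | y₀ , my₀ , p≤y₀ , y₀≢p =
        ⊥-elim (Z-empty y₀ (maximal u y₀ (T-∧-intro my₀ (<ᵇ-intro p≤y₀ (≢-sym y₀≢p))) (λ z zz → ⊥-elim (Z-empty z zz))))

      private
        bottom = argminᵇ (lookup Z) rk (proj₁ above-nonempty) (proj₂ above-nonempty)
        q = proj₁ bottom
        zq = proj₁ (proj₂ bottom)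
        minimum = proj₂ (proj₂ bottom)
        mq = memZ zq
        p≤q = <ᵇ-le (p<Z zq)

        q≤ : ∀ y → T (lookup Z y) → T (le q y)
        q≤ y zy = comparable-rk-≤⇒le q y mq (memZ zy) (chain u q y zq zy) (minimum y zy)

        nothing-between : ∀ z → T (mem z) → T (le p z) → T (le z q) → ¬ z ≡ p → ¬ z ≡ q → ⊥
        nothing-between z mz pz zq′ z≢p z≢q = ℕₚ.<⇒≱ (rk-< z q mz mq zq′ z≢q) (minimum z zz)
          where
            zz = maximal u z (T-∧-intro mz (<ᵇ-intro pz (≢-sym z≢p))) (λ y zy → T-∨ˡ (le-trans z q y zq′ (q≤ y zy)))

      bottom-startsWith : T (startsWithᵇ Z q)
      bottom-startsWith = T-∧-intro cov (T-∧-intro zq (maxChainᵇ-complete (upᵇ q) (Z [ q ]≔ false)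
                            (record { ⊆-region = sub ; chain = ch ; maximal = max })))
        where
          cov = upperCover-intro mq p≤q (sym (nothing-between⇒rk-cover mp mq p≤q (<ᵇ-≢ (p<Z zq)) nothing-between))
          sub : ∀ y → T (lookup (Z [ q ]≔ false) y) → T (upᵇ q y)
          sub y ty = let (y≢q , zy) = remove-∈⁻ Z q y ty in T-∧-intro (memZ zy) (<ᵇ-intro (q≤ y zy) (≢-sym y≢q))
          ch : ∀ y z → T (lookup (Z [ q ]≔ false) y) → T (lookup (Z [ q ]≔ false) z) → T (comparable y z)
          ch y z ty tz = chain u y z (proj₂ (remove-∈⁻ Z q y ty)) (proj₂ (remove-∈⁻ Z q z tz))
          max : ∀ y → T (upᵇ q y) → (∀ z → T (lookup (Z [ q ]≔ false) z) → T (comparable y z)) → T (lookup (Z [ q ]≔ false) y)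
          max y ry cy = update-∈⁺ Z false (≢-sym (<ᵇ-≢ q<y)) (maximal u y (T-∧-intro (upᵇ-mem ry) (<ᵇ-intro py p≢y)) comparable-all)
            where
              q<y = upᵇ-< ry
              py = le-trans p q y p≤q (<ᵇ-le q<y)
              p≢y : ¬ p ≡ y
              p≢y refl = <ᵇ-≢ (p<Z zq) (le-antisym p q p≤q (<ᵇ-le q<y))
              comparable-all : ∀ z → T (lookup Z z) → T (comparable y z)
              comparable-all z zz with z ≟ᶠ q
              ... | yes refl = T-∨ʳ {le y z} (<ᵇ-le q<y)
              ... | no z≢q = cy z (update-∈⁺ Z false z≢q zz)

    step⁻ : ∀ Z → T (upChainᵇ p Z) → ∃[ q ] T (startsWithᵇ Z q)
    step⁻ Z t = _ , bottom-startsWith Z (maxChainᵇ-sound (upᵇ p) Z t)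

    step⁺ : ∀ Z q → T (startsWithᵇ Z q) → T (upChainᵇ p Z)
    step⁺ Z q t = maxChainᵇ-complete (upᵇ p) Z (record { ⊆-region = sub ; chain = ch ; maximal = max })
      where
        cov = T-∧ˡ {upperCoverᵇ p q} t
        zq = T-∧ˡ (T-∧ʳ {upperCoverᵇ p q} t)
        uq = maxChainᵇ-sound (upᵇ q) (Z [ q ]≔ false) (T-∧ʳ {lookup Z q} (T-∧ʳ {upperCoverᵇ p q} t))
        mq = upperCover-mem cov
        p<q = upperCover-< cov
        ∈Z′ : ∀ {y} → ¬ y ≡ q → T (lookup Z y) → T (lookup (Z [ q ]≔ false) y)
        ∈Z′ = update-∈⁺ Z false
        q<Z′ : ∀ {y} → ¬ y ≡ q → T (lookup Z y) → T (q <ᵇ y)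
        q<Z′ y≢q zy = upᵇ-< (⊆-region uq _ (∈Z′ y≢q zy))
        sub : ∀ y → T (lookup Z y) → T (upᵇ p y)
        sub y zy with y ≟ᶠ q
        ... | yes refl = T-∧-intro mq p<q
        ... | no y≢q = T-∧-intro (upᵇ-mem (⊆-region uq y (∈Z′ y≢q zy)))
                                 (<ᵇ-intro (le-trans p q y (<ᵇ-le p<q) (<ᵇ-le (q<Z′ y≢q zy)))
                                           (λ { refl → <ᵇ-≢ p<q (le-antisym p q (<ᵇ-le p<q) (<ᵇ-le (q<Z′ y≢q zy))) }))
        ch : ∀ y z → T (lookup Z y) → T (lookup Z z) → T (comparable y z)
        ch y z zy zz with y ≟ᶠ q | z ≟ᶠ q
        ... | yes refl | yes refl = comparable-refl q
        ... | yes refl | no z≢q = T-∨ˡ (<ᵇ-le (q<Z′ z≢q zz))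
        ... | no y≢q | yes refl = T-∨ʳ {le y q} (<ᵇ-le (q<Z′ y≢q zy))
        ... | no y≢q | no z≢q = chain uq y z (∈Z′ y≢q zy) (∈Z′ z≢q zz)
        max : ∀ y → T (upᵇ p y) → (∀ z → T (lookup Z z) → T (comparable y z)) → T (lookup Z y)
        max y ry cy with y ≟ᶠ q
        ... | yes refl = zq
        ... | no y≢q with T-∨-elim {le y q} (cy q zq)
        ...   | inj₁ yq = ⊥-elim (ℕₚ.<⇒≱ (rk-<ᵇ mp (upᵇ-mem ry) (upᵇ-< ry))
                                   (ℕₚ.≤-pred (subst (rk y <_) (sym (upperCover-rk cov)) (rk-< y q (upᵇ-mem ry) mq yq y≢q))))
        ...   | inj₂ qy = update-∈⁻ Z false y≢q (maximal uq y (T-∧-intro (upᵇ-mem ry) (<ᵇ-intro qy (≢-sym y≢q)))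
                                                  (λ z tz → cy z (proj₂ (remove-∈⁻ Z q z tz))))

    step-unique : ∀ Z q q′ → T (startsWithᵇ Z q) → T (startsWithᵇ Z q′) → q ≡ q′
    step-unique Z q q′ t t′ with q ≟ᶠ q′
    ... | yes q≡q′ = q≡q′
    ... | no q≢q′ = ⊥-elim (ℕₚ.<-irrefl (trans (sym (upperCover-rk cov)) (upperCover-rk cov′))
                             (rk-< q q′ (upperCover-mem cov) (upᵇ-mem q<q′) (<ᵇ-le (upᵇ-< q<q′)) q≢q′))
      where
        cov = T-∧ˡ {upperCoverᵇ p q} t
        cov′ = T-∧ˡ {upperCoverᵇ p q′} t′
        uq = maxChainᵇ-sound (upᵇ q) (Z [ q ]≔ false) (T-∧ʳ {lookup Z q} (T-∧ʳ {upperCoverᵇ p q} t))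
        q<q′ = ⊆-region uq q′ (update-∈⁺ Z false (≢-sym q≢q′) (T-∧ˡ (T-∧ʳ {upperCoverᵇ p q′} t′)))

module ToggleBasics (S : Semifield) (n : ℕ) (le : Fin n → Fin n → Bool) (mem : Fin n → Bool)
                   (rk : Fin n → ℕ) (r : ℕ) (κ : Semifield.Carrier S) where
  open Toggles S n le mem rk r κ

  toggle-elsewhere : ∀ p μ q → ¬ q ≡ p → toggle p μ q ≡ μ q
  toggle-elsewhere p μ q q≢p with q ≟ᶠ p
  ... | yes q≡p = ⊥-elim (q≢p q≡p)
  ... | no _ = refl

  τrank-elsewhere : ∀ i μ y → ¬ rk y ≡ i → τrank i μ y ≡ μ y
  τrank-elsewhere i μ y rky≢i = go (allFin n)
    where
      go : ∀ l → foldr (λ p σ → if mem p ∧ does (rk p ℕ.≟ i) then toggle p σ else σ) μ l y ≡ μ y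
      go [] = refl
      go (p ∷ l) with mem p ∧ does (rk p ℕ.≟ i) in eq
      ... | false = go l
      ... | true = trans (toggle-elsewhere p _ y (λ { refl → rky≢i (ℕₚ.≡ᵇ⇒≡ (rk y) i (T-∧ʳ {mem y} (subst T (sym eq) tt))) })) (go l)

  upFrom-below : ∀ k m μ y → rk y < k → upFrom k m μ y ≡ μ y
  upFrom-below k zero μ y h = τrank-elsewhere k μ y (ℕₚ.<⇒≢ h)
  upFrom-below k (suc m) μ y h =
    trans (τrank-elsewhere (k ℕ.+ suc m) _ y (ℕₚ.<⇒≢ (ℕₚ.<-≤-trans h (ℕₚ.m≤m+n k (suc m))))) (upFrom-below k m μ y h)

  upFrom-above : ∀ k m μ y → k ℕ.+ m < rk y → upFrom k m μ y ≡ μ y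
  upFrom-above k zero μ y h = τrank-elsewhere k μ y (ℕₚ.<⇒≢ (subst (_< rk y) (ℕₚ.+-identityʳ k) h) ∘ sym)
  upFrom-above k (suc m) μ y h =
    trans (τrank-elsewhere (k ℕ.+ suc m) _ y (ℕₚ.<⇒≢ h ∘ sym))
          (upFrom-above k m μ y (ℕₚ.<-trans (subst (k ℕ.+ m <_) (sym (ℕₚ.+-suc k m)) (ℕₚ.n<1+n (k ℕ.+ m))) h))

  upFrom-bottom : ∀ k m μ y → rk y ≡ k → upFrom k m μ y ≡ τrank k μ y
  upFrom-bottom k zero μ y e = refl
  upFrom-bottom k (suc m) μ y e =
    trans (τrank-elsewhere (k ℕ.+ suc m) _ y (λ e′ → ℕₚ.m≢1+m+n k (trans (sym e) (trans e′ (ℕₚ.+-suc k m)))))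
          (upFrom-bottom k m μ y e)

  rvac-minimal : ∀ π x → rk x ≡ 0 → rvac π x ≡ τrank 0 π x
  rvac-minimal π x e = go r
    where
      go : ∀ m → rvacAux m π x ≡ τrank 0 π x
      go zero = upFrom-bottom 0 r π x e
      go (suc m) = trans (upFrom-below (suc m) (r ∸ suc m) (rvacAux m π) x (subst (_< suc m) (sym e) (s≤s z≤n))) (go m)

module ChainSums (S : Semifield) {n : ℕ} {le : Fin n → Fin n → Bool} {mem : Fin n → Bool} {rk : Fin n → ℕ} {r : ℕ}
                 (G : IsGradedRegion n le mem rk r) (κ : Semifield.Carrier S) where
  open SemifieldProperties S
  open ZeroAdjoined S
  open SubsetProduct S
  open GradedRegion G
  module TG = Toggles S n le mem rk r κ
  open TG using (Lab)

  -- Recursive forms of the chain sums D and U over covers; chainSum≡D*U shows that they agree.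
  Dₖ : ℕ → Lab → Fin n → Carrier
  Dₖ zero μ p = μ p
  Dₖ (suc k) μ p = μ p * ∑⁺ (map (Dₖ k μ) (lowerCovers p))

  D : Lab → Fin n → Carrier
  D μ p = Dₖ (rk p) μ p

  Uₖ : ℕ → Lab → Fin n → Carrier
  Uₖ zero μ p = 1#
  Uₖ (suc k) μ p = ∑⁺ (map (λ q → μ q * Uₖ k μ q) (upperCovers p))

  U : Lab → Fin n → Carrier
  U μ p = Uₖ (r ∸ rk p) μ p

  W : Lab → Fin n → Carrier
  W μ p = μ p * U μ p

  D-minimal : ∀ μ p → rk p ≡ 0 → D μ p ≡ μ p
  D-minimal μ p e = cong (λ k → Dₖ k μ p) e

  D-step : ∀ μ p s → rk p ≡ suc s → D μ p ≡ μ p * ∑⁺ (map (D μ) (lowerCovers p))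
  D-step μ p s e = trans (cong (λ k → Dₖ k μ p) e) (cong (λ l → μ p * ∑⁺ l) (map-cong-local (All.tabulate
    λ {q} m → cong (λ k → Dₖ k μ q) (sym (ℕₚ.suc-injective (trans (lowerCover-rk (∈-lowerCovers⁻ m)) e))))))

  U-maximal : ∀ μ p → rk p ≡ r → U μ p ≡ 1#
  U-maximal μ p e = cong (λ k → Uₖ k μ p) (trans (cong (r ∸_) e) (ℕₚ.n∸n≡0 r))

  U-step : ∀ μ p → rk p < r → U μ p ≡ ∑⁺ (map (W μ) (upperCovers p))
  U-step μ p h = trans (cong (λ k → Uₖ k μ p) (ℕₚ.+-∸-assoc 1 h))
    (cong ∑⁺ (map-cong-local (All.tabulate λ {q} m →
      cong (λ k → μ q * Uₖ k μ q) (cong (r ∸_) (upperCover-rk (∈-upperCovers⁻ m))))))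

  Dₖ-cong : ∀ k μ ν p → T (mem p) → (∀ y → T (mem y) → T (le y p) → μ y ≡ ν y) → Dₖ k μ p ≡ Dₖ k ν p
  Dₖ-cong zero μ ν p mp h = h p mp (le-refl p)
  Dₖ-cong (suc k) μ ν p mp h = cong₂ _*_ (h p mp (le-refl p)) (cong ∑⁺ (map-cong-local (All.tabulate λ {q} m →
    let cov = ∈-lowerCovers⁻ m in
    Dₖ-cong k μ ν q (lowerCover-mem cov) (λ y my yq → h y my (le-trans y q p yq (lowerCover-le cov))))))

  D-cong : ∀ μ ν p → T (mem p) → (∀ y → T (mem y) → T (le y p) → μ y ≡ ν y) → D μ p ≡ D ν p
  D-cong μ ν p = Dₖ-cong (rk p) μ ν p

  Uₖ-cong : ∀ k μ ν p → T (mem p) → (∀ y → T (mem y) → T (p <ᵇ y) → μ y ≡ ν y) → Uₖ k μ p ≡ Uₖ k ν p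
  Uₖ-cong zero μ ν p mp h = refl
  Uₖ-cong (suc k) μ ν p mp h = cong ∑⁺ (map-cong-local (All.tabulate λ {q} m →
    let cov = ∈-upperCovers⁻ m
        p<q = upperCover-< cov in
    cong₂ _*_ (h q (upperCover-mem cov) p<q)
              (Uₖ-cong k μ ν q (upperCover-mem cov) (λ y my q<y → h y my (<ᵇ-intro (le-trans p q y (<ᵇ-le p<q) (<ᵇ-le q<y))
                 (λ { refl → <ᵇ-≢ p<q (le-antisym p q (<ᵇ-le p<q) (<ᵇ-le q<y)) }))))))

  U-cong : ∀ μ ν p → T (mem p) → (∀ y → T (mem y) → T (p <ᵇ y) → μ y ≡ ν y) → U μ p ≡ U ν p
  U-cong μ ν p = Uₖ-cong (r ∸ rk p) μ ν p

  W-cong : ∀ μ ν p → T (mem p) → (∀ y → T (mem y) → T (le p y) → μ y ≡ ν y) → W μ p ≡ W ν p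
  W-cong μ ν p mp h = cong₂ _*_ (h p mp (le-refl p)) (U-cong μ ν p mp (λ y my p<y → h y my (<ᵇ-le p<y)))

  downChainSum upChainSum : Lab → Fin n → Carrier₀
  downChainSum μ p = ∑ₛ (λ Y → ⁅ downChainᵇ p Y ⁆ just (∏ μ Y))
  upChainSum μ p = ∑ₛ (λ Z → ⁅ upChainᵇ p Z ⁆ just (∏ μ Z))

  downChainSum-pivot : ∀ μ p →
    downChainSum μ p ≡ ∑ₛ (λ X → ⁅ not (lookup X p) ∧ downChainᵇ p (X [ p ]≔ true) ⁆ just (μ p * ∏ μ X))
  downChainSum-pivot μ p = trans (∑ₛ-pivot p _) (∑ₛ-cong pointwise)
    where
      pointwise : ∀ X → ⁅ not (lookup X p) ⁆ (⁅ downChainᵇ p X ⁆ just (∏ μ X) ⊕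
                                              ⁅ downChainᵇ p (X [ p ]≔ true) ⁆ just (∏ μ (X [ p ]≔ true)))
                      ≡ ⁅ not (lookup X p) ∧ downChainᵇ p (X [ p ]≔ true) ⁆ just (μ p * ∏ μ X)
      pointwise X with lookup X p in eq
      ... | true = refl
      ... | false = cong₂ (λ b v → ⁅ b ⁆ just (∏ μ X) ⊕ ⁅ downChainᵇ p (X [ p ]≔ true) ⁆ just v)
                          (∧-zeroʳ (maxChainᵇ (downᵇ p) X)) (∏-insert μ X p eq)

  downChainSum≡D : ∀ k μ p → T (mem p) → rk p ≡ k → downChainSum μ p ≡ just (D μ p)
  downChainSum≡D zero μ p mp rp = begin
    downChainSum μ p                                       ≡⟨ downChainSum-pivot μ p ⟩
    ∑ₛ (λ X → ⁅ not (lookup X p) ∧ downChainᵇ p (X [ p ]≔ true) ⁆ just (μ p * ∏ μ X))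
      ≡⟨ ∑ₛ-cong (λ X → cong (⁅_⁆ just (μ p * ∏ μ X)) (downChain-minimal p mp rp X)) ⟩
    ∑ₛ (λ X → ⁅ emptyᵇ X ⁆ just (μ p * ∏ μ X))             ≡⟨ ∑ₛ-empty (λ X → just (μ p * ∏ μ X)) ⟩
    just (μ p * ∏ μ (replicate n false))                   ≡⟨ cong just (trans (cong (μ p *_) (∏-empty μ)) (*-identityʳ (μ p))) ⟩
    just (μ p)                                             ≡⟨ cong just (sym (D-minimal μ p rp)) ⟩
    just (D μ p)                                           ∎
  downChainSum≡D (suc s) μ p mp rp = begin
    downChainSum μ p                                       ≡⟨ downChainSum-pivot μ p ⟩
    ∑ₛ (λ X → ⁅ not (lookup X p) ∧ downChainᵇ p (X [ p ]≔ true) ⁆ just (μ p * ∏ μ X))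
      ≡⟨ ∑ₛ-cong (λ X → ∑-indicator-unique _ (λ q → lowerCoverᵇ p q ∧ downChainᵇ q X) _
                          (Step.step-unique X) (Step.step⁻ X) (Step.step⁺ X)) ⟩
    ∑ₛ (λ X → ∑ (allFin n) (λ q → ⁅ lowerCoverᵇ p q ∧ downChainᵇ q X ⁆ just (μ p * ∏ μ X)))
      ≡⟨ ∑-swap (allSubsets n) (allFin n) _ ⟩
    ∑ (allFin n) (λ q → ∑ₛ (λ X → ⁅ lowerCoverᵇ p q ∧ downChainᵇ q X ⁆ just (μ p * ∏ μ X)))
      ≡⟨ ∑-cong (allFin n) (λ q _ → factor q) ⟩
    ∑ (allFin n) (λ q → ⁅ lowerCoverᵇ p q ⁆ (just (μ p) ⊗ downChainSum μ q))
      ≡⟨ sym (∑-filterᵇ (lowerCoverᵇ p) (allFin n) _) ⟩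
    ∑ (lowerCovers p) (λ q → just (μ p) ⊗ downChainSum μ q)
      ≡⟨ ∑-cong (lowerCovers p) (λ q m → let cov = ∈-lowerCovers⁻ m in
           cong (just (μ p) ⊗_) (downChainSum≡D s μ q (lowerCover-mem cov) (ℕₚ.suc-injective (trans (lowerCover-rk cov) rp)))) ⟩
    ∑ (lowerCovers p) (λ q → just (μ p) ⊗ just (D μ q))    ≡⟨ sym (⊗-∑ (just (μ p)) (lowerCovers p) (λ q → just (D μ q))) ⟩
    just (μ p) ⊗ ∑ (lowerCovers p) (λ q → just (D μ q))
      ≡⟨ cong (just (μ p) ⊗_) (∑-just (lowerCovers p) (D μ) (lowerCovers-nonempty p mp (subst (0 <_) (sym rp) (s≤s z≤n)))) ⟩
    just (μ p * ∑⁺ (map (D μ) (lowerCovers p)))            ≡⟨ cong just (sym (D-step μ p s rp)) ⟩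
    just (D μ p)                                           ∎
    where
      module Step = DownStep p mp s rp
      factor : ∀ q → ∑ₛ (λ X → ⁅ lowerCoverᵇ p q ∧ downChainᵇ q X ⁆ just (μ p * ∏ μ X))
                     ≡ ⁅ lowerCoverᵇ p q ⁆ (just (μ p) ⊗ downChainSum μ q)
      factor q = begin
        ∑ₛ (λ X → ⁅ lowerCoverᵇ p q ∧ downChainᵇ q X ⁆ just (μ p * ∏ μ X))
          ≡⟨ ∑ₛ-cong (λ X → ⁅∧⁆ (lowerCoverᵇ p q) (downChainᵇ q X) _) ⟩
        ∑ₛ (λ X → ⁅ lowerCoverᵇ p q ⁆ (⁅ downChainᵇ q X ⁆ (just (μ p) ⊗ just (∏ μ X))))
          ≡⟨ ∑ₛ-⁅⁆ (lowerCoverᵇ p q) (λ X → ⁅ downChainᵇ q X ⁆ (just (μ p) ⊗ just (∏ μ X))) ⟩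
        ⁅ lowerCoverᵇ p q ⁆ ∑ₛ (λ X → ⁅ downChainᵇ q X ⁆ (just (μ p) ⊗ just (∏ μ X)))
          ≡⟨ cong ⁅ lowerCoverᵇ p q ⁆_ (trans (∑ₛ-cong (λ X → ⁅⁆-⊗ (downChainᵇ q X) (just (μ p)) (just (∏ μ X))))
                                              (sym (⊗-∑ₛ (just (μ p)) (λ X → ⁅ downChainᵇ q X ⁆ just (∏ μ X))))) ⟩
        ⁅ lowerCoverᵇ p q ⁆ (just (μ p) ⊗ downChainSum μ q) ∎

  private
    upChain-∌ : ∀ q Z → T (upChainᵇ q Z) → ¬ T (lookup Z q)
    upChain-∌ q Z t zq = <ᵇ-≢ (upᵇ-< (⊆-region (maxChainᵇ-sound (upᵇ q) Z t) q zq)) refl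

    startingAt : Lab → Fin n → Vec Bool n → Carrier₀
    startingAt μ q Z = ⁅ lookup Z q ∧ upChainᵇ q (Z [ q ]≔ false) ⁆ just (∏ μ Z)

    startingAt-sum : ∀ μ q → ∑ₛ (startingAt μ q) ≡ just (μ q) ⊗ upChainSum μ q
    startingAt-sum μ q =
      trans (∑ₛ-pivot q (startingAt μ q))
            (trans (∑ₛ-cong pointwise) (sym (⊗-∑ₛ (just (μ q)) (λ Z → ⁅ upChainᵇ q Z ⁆ just (∏ μ Z)))))
      where
        pointwise : ∀ Z → ⁅ not (lookup Z q) ⁆ (startingAt μ q Z ⊕ startingAt μ q (Z [ q ]≔ true))
                        ≡ just (μ q) ⊗ ⁅ upChainᵇ q Z ⁆ just (∏ μ Z)
        pointwise Z with lookup Z q in eq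
        ... | true = sym (cong (just (μ q) ⊗_) (⁅false⁆ (upChainᵇ q Z) _ (λ t → upChain-∌ q Z t (subst T (sym eq) tt))))
        ... | false = begin
          startingAt μ q (Z [ q ]≔ true)
            ≡⟨ cong (λ b → ⁅ b ∧ upChainᵇ q ((Z [ q ]≔ true) [ q ]≔ false) ⁆ just (∏ μ (Z [ q ]≔ true)))
                    (lookup∘update q Z true) ⟩
          ⁅ upChainᵇ q ((Z [ q ]≔ true) [ q ]≔ false) ⁆ just (∏ μ (Z [ q ]≔ true))
            ≡⟨ cong₂ (λ Z′ v → ⁅ upChainᵇ q Z′ ⁆ just v) (insert-remove Z q true eq) (∏-insert μ Z q eq) ⟩
          ⁅ upChainᵇ q Z ⁆ (just (μ q) ⊗ just (∏ μ Z)) ≡⟨ ⁅⁆-⊗ (upChainᵇ q Z) (just (μ q)) (just (∏ μ Z)) ⟩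
          just (μ q) ⊗ ⁅ upChainᵇ q Z ⁆ just (∏ μ Z) ∎

  upChainSum≡U : ∀ k μ p → T (mem p) → r ∸ rk p ≡ k → upChainSum μ p ≡ just (U μ p)
  upChainSum≡U zero μ p mp e = begin
    upChainSum μ p                              ≡⟨ ∑ₛ-cong (λ Z → cong (⁅_⁆ just (∏ μ Z)) (upChain-maximal p mp rp Z)) ⟩
    ∑ₛ (λ Z → ⁅ emptyᵇ Z ⁆ just (∏ μ Z))        ≡⟨ ∑ₛ-empty (λ Z → just (∏ μ Z)) ⟩
    just (∏ μ (replicate n false))              ≡⟨ cong just (trans (∏-empty μ) (sym (U-maximal μ p rp))) ⟩
    just (U μ p)                                ∎
    where
      rp : rk p ≡ r
      rp = ℕₚ.≤-antisym (rk-≤ p mp) (ℕₚ.m∸n≡0⇒m≤n e)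
  upChainSum≡U (suc k) μ p mp e = begin
    upChainSum μ p
      ≡⟨ ∑ₛ-cong (λ Z → ∑-indicator-unique (upChainᵇ p Z) (Step.startsWithᵇ Z) (just (∏ μ Z))
                          (Step.step-unique Z) (Step.step⁻ Z) (Step.step⁺ Z)) ⟩
    ∑ₛ (λ Z → ∑ (allFin n) (λ q → ⁅ Step.startsWithᵇ Z q ⁆ just (∏ μ Z)))
      ≡⟨ ∑-swap (allSubsets n) (allFin n) _ ⟩
    ∑ (allFin n) (λ q → ∑ₛ (λ Z → ⁅ Step.startsWithᵇ Z q ⁆ just (∏ μ Z)))
      ≡⟨ ∑-cong (allFin n) (λ q _ → trans (∑ₛ-cong (λ Z → ⁅∧⁆ (upperCoverᵇ p q) _ (just (∏ μ Z))))
                                          (trans (∑ₛ-⁅⁆ (upperCoverᵇ p q) (startingAt μ q)) (cong ⁅ upperCoverᵇ p q ⁆_ (startingAt-sum μ q)))) ⟩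
    ∑ (allFin n) (λ q → ⁅ upperCoverᵇ p q ⁆ (just (μ q) ⊗ upChainSum μ q))
      ≡⟨ sym (∑-filterᵇ (upperCoverᵇ p) (allFin n) _) ⟩
    ∑ (upperCovers p) (λ q → just (μ q) ⊗ upChainSum μ q)
      ≡⟨ ∑-cong (upperCovers p) (λ q m → let cov = ∈-upperCovers⁻ m in
           cong (just (μ q) ⊗_) (upChainSum≡U k μ q (upperCover-mem cov)
             (ℕₚ.suc-injective (trans (sym (trans (ℕₚ.+-∸-assoc 1 pr) (cong (λ t → suc (r ∸ t)) (upperCover-rk cov)))) e)))) ⟩
    ∑ (upperCovers p) (λ q → just (W μ q))      ≡⟨ ∑-just (upperCovers p) (W μ) (upperCovers-nonempty p mp pr) ⟩
    just (∑⁺ (map (W μ) (upperCovers p)))       ≡⟨ cong just (sym (U-step μ p pr)) ⟩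
    just (U μ p)                                ∎
    where
      pr : rk p < r
      pr = ℕₚ.m∸n≢0⇒n<m (λ r∸rk≡0 → ℕₚ.0≢1+n (trans (sym r∸rk≡0) e))
      module Step = UpStep p mp pr

  private
    sumMaybe-∷ : ∀ x xs → TG.sumMaybe (x ∷ xs) ≡ just x ⊕ TG.sumMaybe xs
    sumMaybe-∷ x xs with TG.sumMaybe xs
    ... | nothing = refl
    ... | just s = refl

    sumMaybe-filter : ∀ {A : Set} (b : A → Bool) (P? : ∀ x → Dec (T (b x))) (f : A → Carrier) L →
      TG.sumMaybe (map f (filter P? L)) ≡ ∑ L (λ x → ⁅ b x ⁆ just (f x))
    sumMaybe-filter b P? f [] = refl
    sumMaybe-filter b P? f (x ∷ L) with P? x
    ... | yes bx rewrite T-≡true bx = trans (sumMaybe-∷ (f x) (map f (filter P? L))) (cong (just (f x) ⊕_) (sumMaybe-filter b P? f L))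
    ... | no ¬bx rewrite ¬T-≡false ¬bx = sumMaybe-filter b P? f L

  chainSum≡D*U : ∀ μ p → T (mem p) → TG.sumMaybe (map (TG.prodOver μ) (TG.chainsThrough p)) ≡ just (D μ p * U μ p)
  chainSum≡D*U μ p mp = begin
    TG.sumMaybe (map (TG.prodOver μ) (TG.chainsThrough p))
      ≡⟨ sumMaybe-filter (λ X → maxChainᵇ mem X ∧ lookup X p) _ (TG.prodOver μ) (allSubsets n) ⟩
    ∑ₛ (λ X → ⁅ maxChainᵇ mem X ∧ lookup X p ⁆ just (TG.prodOver μ X))
      ≡⟨ ∑ₛ-cong split ⟩
    ∑ₛ (λ X → Dterm (X ∩ downVec p) ⊗ Uterm (X ∖ downVec p))
      ≡⟨ ∑ₛ-split (downVec p) Dterm Uterm ⟩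
    ∑ₛ (λ Y → ⁅ Y ⊆ᵇ downVec p ⁆ Dterm Y) ⊗ ∑ₛ (λ Z → ⁅ disjointᵇ Z (downVec p) ⁆ Uterm Z)
      ≡⟨ cong₂ _⊗_ (∑ₛ-cong (λ Y → ⁅⁆-absorb (Y ⊆ᵇ downVec p) (downChainᵇ p Y) _ (downChain-⊆ p Y)))
                   (∑ₛ-cong (λ Z → ⁅⁆-absorb (disjointᵇ Z (downVec p)) (upChainᵇ p Z) _ (upChain-disjoint p Z))) ⟩
    downChainSum μ p ⊗ upChainSum μ p
      ≡⟨ cong₂ _⊗_ (downChainSum≡D (rk p) μ p mp refl) (upChainSum≡U (r ∸ rk p) μ p mp refl) ⟩
    just (D μ p * U μ p) ∎
    where
      Dterm Uterm : Vec Bool n → Carrier₀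
      Dterm Y = ⁅ downChainᵇ p Y ⁆ just (∏ μ Y)
      Uterm Z = ⁅ upChainᵇ p Z ⁆ just (∏ μ Z)
      split : ∀ X → ⁅ maxChainᵇ mem X ∧ lookup X p ⁆ just (TG.prodOver μ X) ≡ Dterm (X ∩ downVec p) ⊗ Uterm (X ∖ downVec p)
      split X = trans (cong₂ (λ b v → ⁅ b ⁆ just v) (maxChainThroughᵇ-split p X) (trans (foldr≡∏ μ X) (∏-split μ X (downVec p))))
                      (⁅∧⁆-⊗ (downChainᵇ p (X ∩ downVec p)) (upChainᵇ p (X ∖ downVec p)) _ _)

  toggle-at : ∀ μ p → T (mem p) → TG.toggle p μ p ≡ κ * ((D μ p * U μ p) ⁻¹)
  toggle-at μ p mp with eqF p p | T-≡true (eqF-refl p)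
  ... | true | _ with TG.sumMaybe (map (TG.prodOver μ) (TG.chainsThrough p)) | chainSum≡D*U μ p mp
  ...   | just s | refl = refl

  open ToggleBasics S n le mem rk r κ public

  module _ (i : ℕ) (σ : Lab) where
    private
      ofRankᵇ : Fin n → Bool
      ofRankᵇ y = mem y ∧ does (rk y ℕ.≟ i)

      ofRank-rk : ∀ {y} → T (ofRankᵇ y) → rk y ≡ i
      ofRank-rk {y} t = ℕₚ.≡ᵇ⇒≡ (rk y) i (T-∧ʳ {mem y} t)

      toggled : Fin n → Carrier
      toggled y = κ * ((D σ y * U σ y) ⁻¹)

      partial : List (Fin n) → Lab
      partial = foldr (λ p τ → if ofRankᵇ p then TG.toggle p τ else τ) σ

      -- Toggles within one rank do not interact: D and U at p read no other element of p's rank.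
      invariant : ∀ l → Unique l →
        (∀ y → y ∈ l → T (ofRankᵇ y) → partial l y ≡ toggled y) × (∀ y → (y ∈ l → ¬ T (ofRankᵇ y)) → partial l y ≡ σ y)
      invariant [] _ = (λ _ ()) , (λ _ _ → refl)
      invariant (p ∷ l) (p∉l ∷ unique) with invariant l unique | T-dec (ofRankᵇ p)
      ... | (done , untouched) | inj₂ ¬cp rewrite ¬T-≡false ¬cp =
        (λ { y (here refl) cy → ⊥-elim (¬cp cy) ; y (there m) cy → done y m cy }) ,
        (λ y h → untouched y (h ∘ there))
      ... | (done , untouched) | inj₁ cp rewrite T-≡true cp = at-p , elsewhere
        where
          mp = T-∧ˡ cp
          ≢p : ∀ {y} → y ∈ l → ¬ y ≡ p
          ≢p m refl = All.lookup p∉l m refl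
          same-below : ∀ z → T (mem z) → T (le z p) → partial l z ≡ σ z
          same-below z mz zp with z ≟ᶠ p
          ... | yes refl = untouched p (λ m _ → ≢p m refl)
          ... | no z≢p = untouched z (λ _ cz → ℕₚ.<-irrefl (trans (ofRank-rk cz) (sym (ofRank-rk cp))) (rk-< z p mz mp zp z≢p))
          same-above : ∀ z → T (mem z) → T (p <ᵇ z) → partial l z ≡ σ z
          same-above z mz pz = untouched z (λ _ cz → ℕₚ.<-irrefl (trans (ofRank-rk cp) (sym (ofRank-rk cz))) (rk-<ᵇ mp mz pz))
          at-p : ∀ y → y ∈ p ∷ l → T (ofRankᵇ y) → TG.toggle p (partial l) y ≡ toggled y
          at-p y (here refl) _ = trans (toggle-at (partial l) p mp)
            (cong₂ (λ a b → κ * ((a * b) ⁻¹)) (D-cong _ σ p mp same-below) (U-cong _ σ p mp same-above))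
          at-p y (there m) cy = trans (toggle-elsewhere p (partial l) y (≢p m)) (done y m cy)
          elsewhere : ∀ y → (y ∈ p ∷ l → ¬ T (ofRankᵇ y)) → TG.toggle p (partial l) y ≡ σ y
          elsewhere y h = trans (toggle-elsewhere p (partial l) y (λ { refl → h (here refl) cp })) (untouched y (h ∘ there))

    τrank-at : ∀ y → T (mem y) → rk y ≡ i → TG.τrank i σ y ≡ κ * ((D σ y * U σ y) ⁻¹)
    τrank-at y my e = proj₁ (invariant (allFin n) (allFin⁺ n)) y (∈-allFin y) (T-∧-intro my (ℕₚ.≡⇒≡ᵇ (rk y) i e))

module Rowvacuation (S : Semifield) {n : ℕ} {le : Fin n → Fin n → Bool} {mem : Fin n → Bool} {rk : Fin n → ℕ} {r : ℕ}
                    (G : IsGradedRegion n le mem rk r) (κ : Semifield.Carrier S) where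
  open SemifieldProperties S
  open GradedRegion G
  open ChainSums S G κ public
  open TG using (Lab; τrank; upFrom; upper; rvacAux)

  -- Only the value at y has changed below y, so D ν y = ν y · (D μ y / μ y).
  D-after-toggle : ∀ ν μ y → T (mem y) → ν y ≡ κ * ((D μ y * U μ y) ⁻¹) →
    (∀ z → T (mem z) → T (le z y) → ¬ z ≡ y → ν z ≡ μ z) → D ν y ≡ κ * ((W μ y) ⁻¹)
  D-after-toggle ν μ y my νy below = go (rk y) refl
    where
      lower-D : ∀ q → q ∈ lowerCovers y → D ν q ≡ D μ q
      lower-D q m = D-cong ν μ q (lowerCover-mem cov) (λ z mz zq → below z mz (le-trans z q y zq (<ᵇ-le q<y))
                      (λ { refl → <ᵇ-≢ q<y (le-antisym q z (<ᵇ-le q<y) zq) }))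
        where
          cov = ∈-lowerCovers⁻ m
          q<y = lowerCover-< cov
      go : ∀ k → rk y ≡ k → D ν y ≡ κ * ((W μ y) ⁻¹)
      go zero ry = trans (D-minimal ν y ry) (trans νy (cong (λ t → κ * ((t * U μ y) ⁻¹)) (D-minimal μ y ry)))
      go (suc s) ry = begin
        D ν y                                    ≡⟨ D-step ν y s ry ⟩
        ν y * ∑⁺ (map (D ν) (lowerCovers y))     ≡⟨ cong₂ (λ a l → a * ∑⁺ l) νy (map-cong-local (All.tabulate (λ {q} → lower-D q))) ⟩
        (κ * ((D μ y * U μ y) ⁻¹)) * Σμ          ≡⟨ cong (λ t → (κ * ((t * U μ y) ⁻¹)) * Σμ) (D-step μ y s ry) ⟩
        (κ * (((μ y * Σμ) * U μ y) ⁻¹)) * Σμ     ≡⟨ *⁻¹-absorb κ (μ y) Σμ (U μ y) ⟩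
        κ * ((W μ y) ⁻¹)                         ∎
        where Σμ = ∑⁺ (map (D μ) (lowerCovers y))

  D-upFrom : ∀ k m μ y → T (mem y) → k ≤ rk y → rk y ≤ k ℕ.+ m → D (upFrom k m μ) y ≡ κ * ((W μ y) ⁻¹)
  D-upFrom k zero μ y my k≤ ≤k = D-after-toggle (τrank k μ) μ y my (τrank-at k μ y my ry)
      (λ z mz zy z≢y → τrank-elsewhere k μ z (λ e → ℕₚ.<-irrefl (trans e (sym ry)) (rk-< z y mz my zy z≢y)))
    where ry = ℕₚ.≤-antisym (subst (rk y ≤_) (ℕₚ.+-identityʳ k) ≤k) k≤
  D-upFrom k (suc m) μ y my k≤ ≤k with ℕₚ.m≤n⇒m<n∨m≡n ≤k
  ... | inj₁ lt = trans (D-cong ν ν′ y my (λ z mz zy →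
                          τrank-elsewhere (k ℕ.+ suc m) ν′ z (ℕₚ.<⇒≢ (ℕₚ.≤-<-trans (rk-≤-mono z y mz my zy) lt))))
                        (D-upFrom k m μ y my k≤ (ℕₚ.≤-pred (subst (rk y <_) (ℕₚ.+-suc k m) lt)))
    where
      ν′ = upFrom k m μ
      ν = τrank (k ℕ.+ suc m) ν′
  ... | inj₂ eq = trans (D-after-toggle ν ν′ y my (τrank-at (k ℕ.+ suc m) ν′ y my eq)
                           (λ z mz zy z≢y → τrank-elsewhere (k ℕ.+ suc m) ν′ z
                                               (λ e → ℕₚ.<-irrefl (trans e (sym eq)) (rk-< z y mz my zy z≢y))))
                        (cong (λ w → κ * (w ⁻¹)) (W-cong ν′ μ y my (λ z mz yz →
                          upFrom-above k m μ z (ℕₚ.<-≤-trans above (rk-≤-mono y z my mz yz)))))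
    where
      ν′ = upFrom k m μ
      ν = τrank (k ℕ.+ suc m) ν′
      above : k ℕ.+ m < rk y
      above = subst (k ℕ.+ m <_) (trans (sym (ℕₚ.+-suc k m)) (sym eq)) (ℕₚ.n<1+n (k ℕ.+ m))

  D-upper : ∀ j μ y → T (mem y) → j ≤ rk y → D (upper j μ) y ≡ κ * ((W μ y) ⁻¹)
  D-upper j μ y my h = D-upFrom j (r ∸ j) μ y my h (subst (rk y ≤_) (sym (ℕₚ.m+[n∸m]≡n (ℕₚ.≤-trans h (rk-≤ y my)))) (rk-≤ y my))

  -- stage j π is π after the first j factors (τ_r ⋯ τ_0), …, (τ_r ⋯ τ_{j-1}) of rvac.
  stage : ℕ → Lab → Lab
  stage zero π = π
  stage (suc j) π = rvacAux j π

  stage-suc : ∀ j π → stage (suc j) π ≡ upper j (stage j π)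
  stage-suc zero π = refl
  stage-suc (suc j) π = refl

  D-stage : ∀ j π y → T (mem y) → j ≤ rk y → D (stage (suc j) π) y ≡ κ * ((W (stage j π) y) ⁻¹)
  D-stage j π y my h = trans (cong (λ f → D f y) (stage-suc j π)) (D-upper j (stage j π) y my h)

  D-rvacAux : ∀ m π y → T (mem y) → rk y ≤ m → D (rvacAux m π) y ≡ κ * ((W (stage (rk y) π) y) ⁻¹)
  D-rvacAux zero π y my h =
    trans (D-upper 0 π y my z≤n) (cong (λ j → κ * ((W (stage j π) y) ⁻¹)) (sym (ℕₚ.n≤0⇒n≡0 h)))
  D-rvacAux (suc m) π y my h with ℕₚ.m≤n⇒m<n∨m≡n h
  ... | inj₂ eq = trans (D-stage (suc m) π y my (ℕₚ.≤-reflexive (sym eq))) (cong (λ j → κ * ((W (stage j π) y) ⁻¹)) (sym eq))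
  ... | inj₁ lt = trans (D-cong (rvacAux (suc m) π) (rvacAux m π) y my
                          (λ z mz zy → upFrom-below (suc m) (r ∸ suc m) (rvacAux m π) z (ℕₚ.≤-<-trans (rk-≤-mono z y mz my zy) lt)))
                        (D-rvacAux m π y my (ℕₚ.≤-pred lt))

  value-from-D : ∀ μ y s → rk y ≡ suc s → μ y ≡ D μ y * ((∑⁺ (map (D μ) (lowerCovers y))) ⁻¹)
  value-from-D μ y s e = sym (trans (cong (_* ((∑⁺ (map (D μ) (lowerCovers y))) ⁻¹)) (D-step μ y s e)) (x*y*y⁻¹≡x (μ y) _))

  value-from-W : ∀ μ y → μ y ≡ W μ y * ((U μ y) ⁻¹)
  value-from-W μ y = sym (x*y*y⁻¹≡x (μ y) (U μ y))

module GradedPoset (P : FinPoset) {r : ℕ} {rk : Fin (FinPoset.n P) → ℕ} (Gr : IsGraded P r rk) where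
  open FinPoset P renaming (refl to le-refl; trans to le-trans; antisym to le-antisym)
  open IsGraded Gr

  private
    interval : Fin n → Fin n → Subset n
    interval p q = tabulateᵛ (λ z → le p z ∧ le z q)

    ∈-interval⁺ : ∀ {p q z} → T (le p z) → T (le z q) → z ∈ₛ interval p q
    ∈-interval⁺ {z = z} pz zq = lookup⇒[]= z _ (trans (lookup∘tabulate _ z) (T-≡true (T-∧-intro pz zq)))

    ∈-interval⁻ : ∀ {p q z} → z ∈ₛ interval p q → T (le p z) × T (le z q)
    ∈-interval⁻ {p} {q} {z} m = let t = subst T (sym (trans (sym (lookup∘tabulate _ z)) ([]=⇒lookup m))) tt in
                                T-∧ˡ t , T-∧ʳ {le p z} t

    strictlyBetweenᵇ : Fin n → Fin n → Fin n → Bool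
    strictlyBetweenᵇ p q z = le p z ∧ le z q ∧ not (eqF z p) ∧ not (eqF z q)

    -- Strict monotonicity by induction on the size of the interval [p, q]: an element strictly
    -- between p and q splits it into two smaller intervals, and otherwise q covers p.
    rk-<-acc : ∀ p q → Acc _<_ ∣ interval p q ∣ → T (le p q) → ¬ p ≡ q → rk p < rk q
    rk-<-acc p q (acc smaller) pq p≢q with search (strictlyBetweenᵇ p q)
    ... | inj₂ none = ℕₚ.≤-reflexive (sym (cover-rk p q (pq , p≢q , between)))
      where
        between : ∀ z → T (le p z) → T (le z q) → z ≡ p ⊎ z ≡ q
        between z pz zq with z ≟ᶠ p | z ≟ᶠ q
        ... | yes z≡p | _ = inj₁ z≡p
        ... | no _ | yes z≡q = inj₂ z≡q
        ... | no z≢p | no z≢q =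
          ⊥-elim (none z (T-∧-intro pz (T-∧-intro zq (T-∧-intro (T-not-intro (z≢p ∘ eqF-sound)) (T-not-intro (z≢q ∘ eqF-sound))))))
    ... | inj₁ (z , t) = ℕₚ.<-trans (rk-<-acc p z (smaller (p⊂q⇒∣p∣<∣q∣ [p,z]⊂[p,q])) pz (≢-sym z≢p))
                                    (rk-<-acc z q (smaller (p⊂q⇒∣p∣<∣q∣ [z,q]⊂[p,q])) zq z≢q)
      where
        pz = T-∧ˡ t
        zq = T-∧ˡ (T-∧ʳ {le p z} t)
        rest = T-∧ʳ {le z q} (T-∧ʳ {le p z} t)
        z≢p : ¬ z ≡ p
        z≢p refl = T-not-elim (T-∧ˡ rest) (eqF-refl z)
        z≢q : ¬ z ≡ q
        z≢q refl = T-not-elim (T-∧ʳ {not (eqF z p)} rest) (eqF-refl z)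
        [p,z]⊂[p,q] : interval p z ⊂ interval p q
        [p,z]⊂[p,q] = (λ m → let (px , xz) = ∈-interval⁻ m in ∈-interval⁺ px (le-trans _ z q xz zq))
                    , q , ∈-interval⁺ pq (le-refl q) , λ m → z≢q (le-antisym z q zq (proj₂ (∈-interval⁻ m)))
        [z,q]⊂[p,q] : interval z q ⊂ interval p q
        [z,q]⊂[p,q] = (λ m → let (zx , xq) = ∈-interval⁻ m in ∈-interval⁺ (le-trans p z _ pz zx) xq)
                    , p , ∈-interval⁺ (le-refl p) pq , λ m → z≢p (le-antisym z p (proj₁ (∈-interval⁻ m)) pz)

  rk-< : ∀ p q → T (le p q) → ¬ p ≡ q → rk p < rk q
  rk-< p q = rk-<-acc p q (<-wellFounded _)

  private
    non-extremal : ∀ p (φ : Fin n → Bool) → ¬ (∀ q → T (φ q) → q ≡ p) → ∃[ q ] (T (φ q) × ¬ q ≡ p)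
    non-extremal p φ not-extremal with search (λ q → φ q ∧ not (eqF q p))
    ... | inj₁ (q , t) = q , T-∧ˡ t , (λ { refl → T-not-elim (T-∧ʳ {φ q} t) (eqF-refl q) })
    ... | inj₂ none = ⊥-elim (not-extremal extremal)
      where
        extremal : ∀ q → T (φ q) → q ≡ p
        extremal q φq with q ≟ᶠ p
        ... | yes q≡p = q≡p
        ... | no q≢p = ⊥-elim (none q (T-∧-intro φq (T-not-intro (q≢p ∘ eqF-sound))))

  rk-≤-mono : ∀ p q → T (le p q) → rk p ≤ rk q
  rk-≤-mono p q pq with p ≟ᶠ q
  ... | yes refl = ℕₚ.≤-refl
  ... | no p≢q = ℕₚ.<⇒≤ (rk-< p q pq p≢q)

  rk-≤ : ∀ p → rk p ≤ r
  rk-≤ p with argmaxᵇ (le p) rk p (le-refl p)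
  ... | q , p≤q , maximum = subst (rk p ≤_) (max-rk q maximal) (rk-≤-mono p q p≤q)
    where
      maximal : Maximal P q
      maximal q′ q≤q′ with q′ ≟ᶠ q
      ... | yes q′≡q = q′≡q
      ... | no q′≢q = ⊥-elim (ℕₚ.<⇒≱ (rk-< q q′ q≤q′ (≢-sym q′≢q)) (maximum q′ (le-trans p q q′ p≤q q≤q′)))

  isGradedRegion : IsGradedRegion n le (λ _ → true) rk r
  isGradedRegion = record
    { le-refl = le-refl ; le-antisym = le-antisym ; le-trans = le-trans
    ; rk-< = λ p q _ _ → rk-< p q
    ; rk-cover = λ p q _ _ pq p≢q between → cover-rk p q (pq , p≢q , (λ z → between z tt))
    ; exists-below = λ p _ pos → let (q , qp , q≢p) = non-extremal p (λ q → le q p) (λ minimal → ℕₚ.<-irrefl (sym (min-rk p minimal)) pos)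
                                 in q , tt , qp , q≢p
    ; exists-above = λ p _ p<r → let (q , pq , q≢p) = non-extremal p (le p) (λ maximal → ℕₚ.<-irrefl (max-rk p maximal) p<r)
                                 in q , tt , pq , q≢p
    ; rk-≤ = λ p _ → rk-≤ p }

module PositiveRanks (P : FinPoset) {r : ℕ} {rk : Fin (FinPoset.n P) → ℕ} (Gr : IsGraded P r rk) where
  open FinPoset P using (n; le)
  module GP = GradedPoset P Gr
  module RegionP = GradedRegion GP.isGradedRegion

  positiveᵇ : Fin n → Bool
  positiveᵇ p = 1 ≤ᵇ rk p

  positive⁺ : ∀ {p} → 1 ≤ rk p → T (positiveᵇ p)
  positive⁺ = ℕₚ.≤⇒≤ᵇ

  positive⁻ : ∀ {p} → T (positiveᵇ p) → 1 ≤ rk p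
  positive⁻ {p} = ℕₚ.≤ᵇ⇒≤ 1 (rk p)

  ≡suc[∸1] : ∀ {a} → 1 ≤ a → a ≡ suc (a ∸ 1)
  ≡suc[∸1] (s≤s _) = refl

  ∸1-reflects-< : ∀ {a b} → 1 ≤ a → a ∸ 1 < b ∸ 1 → a < b
  ∸1-reflects-< {suc a} {suc b} _ a<b = s≤s a<b

  isGradedRegion : IsGradedRegion n le positiveᵇ (λ p → rk p ∸ 1) (r ∸ 1)
  isGradedRegion = record
    { le-refl = RegionP.le-refl ; le-antisym = RegionP.le-antisym ; le-trans = RegionP.le-trans
    ; rk-< = λ p q mp _ pq p≢q → ℕₚ.∸-monoˡ-< (GP.rk-< p q pq p≢q) (positive⁻ mp)
    ; rk-cover = cover
    ; exists-below = below
    ; exists-above = above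
    ; rk-≤ = λ p _ → ℕₚ.∸-monoˡ-≤ 1 (GP.rk-≤ p) }
    where
      cover : ∀ p q → T (positiveᵇ p) → T (positiveᵇ q) → T (le p q) → ¬ p ≡ q →
              (∀ z → T (positiveᵇ z) → T (le p z) → T (le z q) → z ≡ p ⊎ z ≡ q) → rk q ∸ 1 ≡ suc (rk p ∸ 1)
      cover p q mp _ pq p≢q between =
        trans (cong (_∸ 1) (RegionP.rk-cover p q tt tt pq p≢q (λ z _ pz zq →
                 between z (positive⁺ (ℕₚ.≤-trans (positive⁻ mp) (GP.rk-≤-mono p z pz))) pz zq)))
              (≡suc[∸1] (positive⁻ mp))
      below : ∀ p → T (positiveᵇ p) → 0 < rk p ∸ 1 → ∃[ q ] (T (positiveᵇ q) × T (le q p) × ¬ q ≡ p)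
      below p mp pos with RegionP.lowerCovers-nonempty p tt (ℕₚ.≤-trans (s≤s z≤n) (positive⁻ mp))
      ... | q , m = q , positive⁺ (ℕₚ.≤-pred (subst (2 ≤_) (sym (RegionP.lowerCover-rk cov)) 2≤rkp)) , RegionP.lowerCover-le cov
                  , λ { refl → ℕₚ.1+n≰n (ℕₚ.≤-reflexive (RegionP.lowerCover-rk cov)) }
        where
          cov = RegionP.∈-lowerCovers⁻ m
          2≤rkp : 2 ≤ rk p
          2≤rkp = subst (2 ≤_) (sym (≡suc[∸1] (positive⁻ mp))) (s≤s pos)
      above : ∀ p → T (positiveᵇ p) → rk p ∸ 1 < r ∸ 1 → ∃[ q ] (T (positiveᵇ q) × T (le p q) × ¬ q ≡ p)
      above p mp p<r with RegionP.upperCovers-nonempty p tt (∸1-reflects-< (positive⁻ mp) p<r)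
      ... | q , m = q , positive⁺ (subst (1 ≤_) (RegionP.upperCover-rk cov) (s≤s z≤n)) , RegionP.upperCover-le cov
                  , ≢-sym (RegionP.<ᵇ-≢ (RegionP.upperCover-< cov))
        where cov = RegionP.∈-upperCovers⁻ m

filterᵇ-cong : ∀ {A : Set} {c d : A → Bool} → (∀ q → c q ≡ d q) → ∀ l → filterᵇ c l ≡ filterᵇ d l
filterᵇ-cong c≗d [] = refl
filterᵇ-cong {c = c} {d} c≗d (x ∷ l) with c x | d x | c≗d x
... | true | true | _ = cong (x ∷_) (filterᵇ-cong c≗d l)
... | false | false | _ = filterᵇ-cong c≗d l

module Restriction (S : Semifield) (P : FinPoset) {r : ℕ} {rk : Fin (FinPoset.n P) → ℕ} (Gr : IsGraded P r rk)
                   (κ : Semifield.Carrier S) where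
  open FinPoset P using (n; le)
  open SemifieldProperties S
  open PositiveRanks P Gr
  module Region₁ = GradedRegion isGradedRegion
  module ℙ = Rowvacuation S GP.isGradedRegion κ
  module ℙ₁ = Rowvacuation S isGradedRegion κ

  lowerCovers-agree : ∀ y → 2 ≤ rk y → RegionP.lowerCovers y ≡ Region₁.lowerCovers y
  lowerCovers-agree y 2≤y = filterᵇ-cong (λ q → T-ext to from) (allFin n)
    where
      to : ∀ {q} → T (RegionP.lowerCoverᵇ y q) → T (Region₁.lowerCoverᵇ y q)
      to {q} t = let e = RegionP.lowerCover-rk t
                     1≤q = ℕₚ.≤-pred (subst (2 ≤_) (sym e) 2≤y) in
                 Region₁.lowerCover-intro (positive⁺ 1≤q) (RegionP.lowerCover-le t) (trans (sym (≡suc[∸1] 1≤q)) (cong (_∸ 1) e))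
      from : ∀ {q} → T (Region₁.lowerCoverᵇ y q) → T (RegionP.lowerCoverᵇ y q)
      from {q} t = RegionP.lowerCover-intro tt (Region₁.lowerCover-le t)
        (trans (cong suc (≡suc[∸1] (positive⁻ (Region₁.lowerCover-mem t))))
               (trans (cong suc (Region₁.lowerCover-rk t)) (sym (≡suc[∸1] (ℕₚ.≤-trans (s≤s z≤n) 2≤y)))))

  upperCovers-agree : ∀ y → 1 ≤ rk y → RegionP.upperCovers y ≡ Region₁.upperCovers y
  upperCovers-agree y 1≤y = filterᵇ-cong (λ q → T-ext to from) (allFin n)
    where
      to : ∀ {q} → T (RegionP.upperCoverᵇ y q) → T (Region₁.upperCoverᵇ y q)
      to {q} t = let e = RegionP.upperCover-rk t in
                 Region₁.upperCover-intro (positive⁺ (subst (1 ≤_) e (s≤s z≤n))) (RegionP.upperCover-le t)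
                   (trans (sym (≡suc[∸1] 1≤y)) (cong (_∸ 1) e))
      from : ∀ {q} → T (Region₁.upperCoverᵇ y q) → T (RegionP.upperCoverᵇ y q)
      from {q} t = RegionP.upperCover-intro tt (Region₁.upperCover-le t)
        (trans (cong suc (≡suc[∸1] 1≤y)) (trans (cong suc (Region₁.upperCover-rk t)) (sym (≡suc[∸1] (positive⁻ (Region₁.upperCover-mem t))))))

  U-agree : ∀ μ y → 1 ≤ rk y → ℙ.U μ y ≡ ℙ₁.U μ y
  U-agree μ y 1≤y = go (r ∸ rk y) y 1≤y refl
    where
      go : ∀ k y → 1 ≤ rk y → r ∸ rk y ≡ k → ℙ.U μ y ≡ ℙ₁.U μ y
      go zero y 1≤y e = trans (ℙ.U-maximal μ y ry) (sym (ℙ₁.U-maximal μ y (cong (_∸ 1) ry)))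
        where ry = ℕₚ.≤-antisym (GP.rk-≤ y) (ℕₚ.m∸n≡0⇒m≤n e)
      go (suc k) y 1≤y e = begin
        ℙ.U μ y                                         ≡⟨ ℙ.U-step μ y y<r ⟩
        ∑⁺ (map (ℙ.W μ) (RegionP.upperCovers y))
          ≡⟨ cong ∑⁺ (map-cong-local (All.tabulate (λ {q} m → cong (μ q *_) (go k q (1≤q m) (k≡ m))))) ⟩
        ∑⁺ (map (ℙ₁.W μ) (RegionP.upperCovers y))      ≡⟨ cong (∑⁺ ∘ map (ℙ₁.W μ)) (upperCovers-agree y 1≤y) ⟩
        ∑⁺ (map (ℙ₁.W μ) (Region₁.upperCovers y))      ≡⟨ sym (ℙ₁.U-step μ y (ℕₚ.∸-monoˡ-< y<r 1≤y)) ⟩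
        ℙ₁.U μ y                                        ∎
        where
          y<r = ℕₚ.m∸n≢0⇒n<m (λ r∸y≡0 → ℕₚ.0≢1+n (trans (sym r∸y≡0) e))
          cover : ∀ {q} → q ∈ RegionP.upperCovers y → suc (rk y) ≡ rk q
          cover m = RegionP.upperCover-rk (RegionP.∈-upperCovers⁻ m)
          1≤q : ∀ {q} → q ∈ RegionP.upperCovers y → 1 ≤ rk q
          1≤q m = subst (1 ≤_) (cover m) (s≤s z≤n)
          k≡ : ∀ {q} → q ∈ RegionP.upperCovers y → r ∸ rk q ≡ k
          k≡ m = ℕₚ.suc-injective (trans (sym (trans (ℕₚ.+-∸-assoc 1 y<r) (cong (λ t → suc (r ∸ t)) (cover m)))) e)

  W-agree : ∀ μ y → 1 ≤ rk y → ℙ.W μ y ≡ ℙ₁.W μ y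
  W-agree μ y 1≤y = cong (μ y *_) (U-agree μ y 1≤y)

  module _ (π : Fin n → Carrier) where
    private
      X = ℙ.TG.rvac π

    stages-agree : ∀ j y → suc j ≤ rk y → ℙ₁.stage j π y ≡ ℙ.stage j π y
    stages-agree zero y _ = refl
    stages-agree (suc j) y h = begin
      ℙ₁.stage (suc j) π y
        ≡⟨ ℙ₁.value-from-D μ₁ y (rk y ∸ 1 ∸ 1) (≡suc[∸1] (ℕₚ.≤-trans (s≤s z≤n) (ℕₚ.∸-monoˡ-≤ 1 h))) ⟩
      ℙ₁.D μ₁ y * ((∑⁺ (map (ℙ₁.D μ₁) (Region₁.lowerCovers y))) ⁻¹)
        ≡⟨ cong₂ (λ a l → a * ((∑⁺ l) ⁻¹)) (D-agree y (ℕₚ.≤-trans (ℕₚ.n≤1+n (suc j)) h))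
                 (trans (cong (map (ℙ₁.D μ₁)) (sym (lowerCovers-agree y (ℕₚ.≤-trans (s≤s (s≤s z≤n)) h))))
                        (map-cong-local (All.tabulate (λ {q} m → D-agree q (below-cover m))))) ⟩
      ℙ.D μ y * ((∑⁺ (map (ℙ.D μ) (RegionP.lowerCovers y))) ⁻¹)
        ≡⟨ sym (ℙ.value-from-D μ y (rk y ∸ 1) (≡suc[∸1] (ℕₚ.≤-trans (s≤s z≤n) h))) ⟩
      ℙ.stage (suc j) π y ∎
      where
        μ₁ = ℙ₁.stage (suc j) π
        μ = ℙ.stage (suc j) π
        below-cover : ∀ {q} → q ∈ RegionP.lowerCovers y → suc j ≤ rk q
        below-cover m = ℕₚ.≤-pred (subst (suc (suc j) ≤_) (sym (RegionP.lowerCover-rk (RegionP.∈-lowerCovers⁻ m))) h)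
        D-agree : ∀ z → suc j ≤ rk z → ℙ₁.D μ₁ z ≡ ℙ.D μ z
        D-agree z hz = begin
          ℙ₁.D μ₁ z                          ≡⟨ ℙ₁.D-stage j π z (positive⁺ 1≤z) (ℕₚ.∸-monoˡ-≤ 1 hz) ⟩
          κ * ((ℙ₁.W (ℙ₁.stage j π) z) ⁻¹)   ≡⟨ cong (λ w → κ * (w ⁻¹)) (sym (W-agree (ℙ₁.stage j π) z 1≤z)) ⟩
          κ * ((ℙ.W (ℙ₁.stage j π) z) ⁻¹)    ≡⟨ cong (λ w → κ * (w ⁻¹)) (ℙ.W-cong (ℙ₁.stage j π) (ℙ.stage j π) z tt
                                                   (λ w _ zw → stages-agree j w (ℕₚ.≤-trans hz (GP.rk-≤-mono z w zw)))) ⟩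
          κ * ((ℙ.W (ℙ.stage j π) z) ⁻¹)     ≡⟨ sym (ℙ.D-stage j π z tt (ℕₚ.≤-trans (ℕₚ.n≤1+n j) hz)) ⟩
          ℙ.D μ z                            ∎
          where 1≤z = ℕₚ.≤-trans (s≤s z≤n) hz

    W-rvac : ∀ k j y → rk y ≡ suc j → r ∸ rk y ≡ k → ℙ.W X y ≡ ℙ.W (ℙ.stage j π) y
    U-rvac : ∀ k j y → rk y ≡ suc j → r ∸ rk y ≡ k → ℙ.U X y ≡ ℙ.U (ℙ.stage (suc j) π) y

    W-rvac k j y ry e = begin
      ℙ.W X y                                               ≡⟨ cong₂ _*_ X-value (U-rvac k j y ry e) ⟩
      ((κ * ((ℙ.W μ′ y) ⁻¹)) * (b ⁻¹)) * u                  ≡⟨ cong (λ w → ((κ * (w ⁻¹)) * (b ⁻¹)) * u) W′-value ⟩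
      ((κ * ((((κ * (c ⁻¹)) * (b ⁻¹)) * u) ⁻¹)) * (b ⁻¹)) * u ≡⟨ rescaled-⁻¹-involutive κ b u c ⟩
      c                                                     ∎
      where
        μ = ℙ.stage j π
        μ′ = ℙ.stage (suc j) π
        c = ℙ.W μ y
        u = ℙ.U μ′ y
        b = ∑⁺ (map (λ q → κ * ((ℙ.W μ q) ⁻¹)) (RegionP.lowerCovers y))
        rk-cover : ∀ {q} → q ∈ RegionP.lowerCovers y → rk q ≡ j
        rk-cover m = ℕₚ.suc-injective (trans (RegionP.lowerCover-rk (RegionP.∈-lowerCovers⁻ m)) ry)
        X-value : X y ≡ (κ * ((ℙ.W μ′ y) ⁻¹)) * (b ⁻¹)
        X-value = trans (ℙ.value-from-D X y j ry) (cong₂ (λ a l → a * ((∑⁺ l) ⁻¹))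
          (trans (ℙ.D-rvacAux r π y tt (GP.rk-≤ y)) (cong (λ t → κ * ((ℙ.W (ℙ.stage t π) y) ⁻¹)) ry))
          (map-cong-local (All.tabulate (λ {q} m →
            trans (ℙ.D-rvacAux r π q tt (GP.rk-≤ q)) (cong (λ t → κ * ((ℙ.W (ℙ.stage t π) q) ⁻¹)) (rk-cover m))))))
        W′-value : ℙ.W μ′ y ≡ ((κ * (c ⁻¹)) * (b ⁻¹)) * u
        W′-value = cong (_* u) (trans (ℙ.value-from-D μ′ y j ry) (cong₂ (λ a l → a * ((∑⁺ l) ⁻¹))
          (ℙ.D-stage j π y tt (subst (j ≤_) (sym ry) (ℕₚ.n≤1+n j)))
          (map-cong-local (All.tabulate (λ {q} m → ℙ.D-stage j π q tt (ℕₚ.≤-reflexive (sym (rk-cover m))))))))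

    U-rvac zero j y ry e = trans (ℙ.U-maximal X y y≡r) (sym (ℙ.U-maximal (ℙ.stage (suc j) π) y y≡r))
      where y≡r = ℕₚ.≤-antisym (GP.rk-≤ y) (ℕₚ.m∸n≡0⇒m≤n e)
    U-rvac (suc k) j y ry e =
      trans (ℙ.U-step X y y<r) (trans (cong ∑⁺ (map-cong-local (All.tabulate (λ {q} m →
          W-rvac k (suc j) q (trans (sym (cover m)) (cong suc ry))
                 (ℕₚ.suc-injective (trans (sym (trans (ℕₚ.+-∸-assoc 1 y<r) (cong (λ t → suc (r ∸ t)) (cover m)))) e))))))
        (sym (ℙ.U-step (ℙ.stage (suc j) π) y y<r)))
      where
        y<r = ℕₚ.m∸n≢0⇒n<m (λ r∸y≡0 → ℕₚ.0≢1+n (trans (sym r∸y≡0) e))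
        cover : ∀ {q} → q ∈ RegionP.upperCovers y → suc (rk y) ≡ rk q
        cover m = RegionP.upperCover-rk (RegionP.∈-upperCovers⁻ m)

    module _ (σ : Fin n → Carrier) (ρσ≡rvac : ∀ y → 1 ≤ rk y → ℙ₁.TG.rowmotion σ y ≡ ℙ₁.TG.rvac π y) where

      W-rowmotion-preimage : ∀ y → 1 ≤ rk y → ℙ.W σ y ≡ ℙ.W X y
      W-rowmotion-preimage y 1≤y = begin
        ℙ.W σ y                   ≡⟨ W-agree σ y 1≤y ⟩
        ℙ₁.W σ y                  ≡⟨ *⁻¹-injective κ (begin
                                       κ * ((ℙ₁.W σ y) ⁻¹)              ≡⟨ sym (ℙ₁.D-upper 0 σ y my z≤n) ⟩
                                       ℙ₁.D (ℙ₁.TG.rowmotion σ) y       ≡⟨ ℙ₁.D-cong _ _ y my (λ z mz _ → ρσ≡rvac z (positive⁻ mz)) ⟩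
                                       ℙ₁.D (ℙ₁.TG.rvac π) y            ≡⟨ ℙ₁.D-rvacAux (r ∸ 1) π y my (Region₁.rk-≤ y my) ⟩
                                       κ * ((ℙ₁.W (ℙ₁.stage j π) y) ⁻¹) ∎) ⟩
        ℙ₁.W (ℙ₁.stage j π) y     ≡⟨ sym (W-agree (ℙ₁.stage j π) y 1≤y) ⟩
        ℙ.W (ℙ₁.stage j π) y
          ≡⟨ ℙ.W-cong _ _ y tt (λ z _ yz → stages-agree j z (ℕₚ.≤-trans (ℕₚ.≤-reflexive (sym ry)) (GP.rk-≤-mono y z yz))) ⟩
        ℙ.W (ℙ.stage j π) y       ≡⟨ sym (W-rvac (r ∸ rk y) j y ry refl) ⟩
        ℙ.W X y                   ∎
        where
          my = positive⁺ 1≤y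
          j = rk y ∸ 1
          ry = ≡suc[∸1] 1≤y

      rvac-restriction : ∀ x → 1 ≤ rk x → X x ≡ σ x
      rvac-restriction x 1≤x = begin
        X x                            ≡⟨ ℙ.value-from-W X x ⟩
        ℙ.W X x * ((ℙ.U X x) ⁻¹)       ≡⟨ cong₂ (λ w u → w * (u ⁻¹)) (sym (W-rowmotion-preimage x 1≤x)) (sym U-agree-σ) ⟩
        ℙ.W σ x * ((ℙ.U σ x) ⁻¹)       ≡⟨ sym (ℙ.value-from-W σ x) ⟩
        σ x                            ∎
        where
          U-agree-σ : ℙ.U σ x ≡ ℙ.U X x
          U-agree-σ with ℕₚ.m≤n⇒m<n∨m≡n (GP.rk-≤ x)
          ... | inj₂ x≡r = trans (ℙ.U-maximal σ x x≡r) (sym (ℙ.U-maximal X x x≡r))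
          ... | inj₁ x<r = trans (ℙ.U-step σ x x<r) (trans (cong ∑⁺ (map-cong-local (All.tabulate (λ {q} m →
                  W-rowmotion-preimage q (subst (1 ≤_) (RegionP.upperCover-rk (RegionP.∈-upperCovers⁻ m)) (s≤s z≤n))))))
                  (sym (ℙ.U-step X x x<r)))

lemma2p39 : (S : Semifield) (P : FinPoset) (r : ℕ) (rk : Fin (FinPoset.n P) → ℕ)
    → IsGraded P r rk
    → (κ : Semifield.Carrier S) (π : Fin (FinPoset.n P) → Semifield.Carrier S)
    → (x : Fin (FinPoset.n P))
    → ((rk x ≡ 0) → rvacP S P r rk κ π x ≡ τ₀P S P r rk κ π x)
    × (1 ≤ rk x
    → ∀ (σ : Fin (FinPoset.n P) → Semifield.Carrier S)
    → (∀ y → 1 ≤ rk y → rowmotionP≥1 S P r rk κ σ y ≡ rvacP≥1 S P r rk κ π y)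
    → rvacP S P r rk κ π x ≡ σ x)
lemma2p39 S P r rk Gr κ π x =
    ToggleBasics.rvac-minimal S (FinPoset.n P) (FinPoset.le P) (λ _ → true) rk r κ π x
  , λ 1≤x σ ρσ≡rvac → Restriction.rvac-restriction S P Gr κ π σ ρσ≡rvac x 1≤x
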